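{- Let $M$ be a matroid. The following are equivalent: (i) $M$ is an odd-$C_3^+$, i.e. $M$ is isomorphic to the circuit matroid of an odd-$C_3^+$ graph; (ii) the ground set of $M$ is the union of two circuits $C_1$ and $C_2$ of $M$ such that $|C_1|$ is odd, $|C_2\setminus C_1|$ is odd, and $M$ has exactly three circuits, namely $C_1$, $C_2$ and $C_1\Delta C_2$.
   Context: Matroids are loopless. Graphs are finite, may have parallel edges but no loops. A totally odd subdivision of a graph $H$ is obtained by replacing each edge $e$ of $H$ by a path with an odd number of edges joining the ends of $e$, paths for distinct edges sharing no inner vertices. $C_3^+$ is the triangle $K_3$ with one edge doubled by a parallel edge; an odd-$C_3^+$ graph is a totally odd subdivision of $C_3^+$. $\Delta$ denotes symmetric difference. -}

module Defs where

open import Data.Nat using (ℕ; zero; suc; _+_; _*_; _<_; _%_)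
open import Data.Fin using (Fin; zero; suc; toℕ; inject₁; fromℕ)
open import Data.Fin.Subset using (Subset; _∈_; _∉_; _⊆_; _∪_; _─_; _-_; ⁅_⁆; Nonempty)
open import Data.Bool using (Bool; _xor_)
open import Data.Vec using (zipWith; tabulate; lookup)
open import Data.Product using (Σ; ∃; ∃-syntax; _×_; _,_; proj₁; proj₂)
open import Data.Sum using (_⊎_)
open import Relation.Nullary using (¬_)
open import Relation.Binary.PropositionalEquality using (_≡_; _≢_)
open import Function.Definitions using (Injective)
open import Function.Bundles using (_⤖_; _⇔_; module Bijection)

Odd : ℕ → Set
Odd n = n % 2 ≡ 1

_Δ_ : ∀ {n} → Subset n → Subset n → Subset n
p Δ q = zipWith _xor_ p q

record Matroid (n : ℕ) : Set₁ where
  field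
    Circuit      : Subset n → Set
    circ-nonempty : ∀ C → Circuit C → Nonempty C
    circ-minimal  : ∀ C D → Circuit C → Circuit D → C ⊆ D → C ≡ D
    circ-elim     : ∀ C D e → Circuit C → Circuit D → C ≢ D → e ∈ C → e ∈ D →
                    ∃[ F ] (Circuit F × F ⊆ ((C ∪ D) - e))
    loopless      : ∀ e → ¬ Circuit ⁅ e ⁆

open Matroid public

record Graph : Set where
  field
    nV   : ℕ
    nE   : ℕ
    ends : Fin nE → Fin nV × Fin nV
    no-loop : ∀ e → proj₁ (ends e) ≢ proj₂ (ends e)

open Graph public

Joins : (G : Graph) → Fin (nE G) → Fin (nV G) → Fin (nV G) → Set
Joins G e x y = (ends G e ≡ (x , y)) ⊎ (ends G e ≡ (y , x))

record Path (G : Graph) (k : ℕ) : Set where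
  field
    vert      : Fin (suc k) → Fin (nV G)
    edge      : Fin k → Fin (nE G)
    vert-inj  : Injective _≡_ _≡_ vert
    edge-inj  : Injective _≡_ _≡_ edge
    edge-join : ∀ i → Joins G (edge i) (vert (inject₁ i)) (vert (suc i))

open Path public

start : ∀ {G k} → Path G k → Fin (nV G)
start P = vert P zero

finish : ∀ {G k} → Path G k → Fin (nV G)
finish {k = k} P = vert P (fromℕ k)

-- C is the edge set of a cycle of G: a path with at least one edge
-- closed up by a further edge e (not on the path) joining its ends.
IsCycleSet : (G : Graph) → Subset (nE G) → Set
IsCycleSet G C =
  ∃[ k ] Σ (Path G (suc k)) λ P → ∃[ e ]
    ( (∀ i → edge P i ≢ e)
    × Joins G e (finish P) (start P)
    × (∀ f → (f ∈ C → (f ≡ e ⊎ ∃[ i ] edge P i ≡ f))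
           × ((f ≡ e ⊎ ∃[ i ] edge P i ≡ f) → f ∈ C)) )

-- M is isomorphic to the circuit matroid M(G): a bijection σ from the
-- ground set of M onto E(G) carrying circuits of M exactly onto the
-- edge sets of cycles of G.
IsoToCycleMatroid : ∀ {n} → Matroid n → Graph → Set
IsoToCycleMatroid {n} M G =
  Σ (Fin n ⤖ Fin (nE G))
    λ σ → ∀ (D : Subset (nE G)) →
      IsCycleSet G D ⇔ Circuit M (tabulate λ i → lookup D (Bijection.to σ i))

record TotallyOddSubdivision (G H : Graph) : Set where
  field
    φ      : Fin (nV H) → Fin (nV G)
    φ-inj  : Injective _≡_ _≡_ φ
    len    : Fin (nE H) → ℕ
    len-odd : ∀ f → Odd (len f)
    path   : (f : Fin (nE H)) → Path G (len f)
    path-start  : ∀ f → start (path f) ≡ φ (proj₁ (ends H f))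
    path-finish : ∀ f → finish (path f) ≡ φ (proj₂ (ends H f))
    edge-cover : ∀ e → ∃[ f ] ∃[ i ] edge (path f) i ≡ e
    edge-uniq  : ∀ f g i j → edge (path f) i ≡ edge (path g) j →
                 f ≡ g × toℕ i ≡ toℕ j
    vert-cover : ∀ v → (∃[ u ] φ u ≡ v) ⊎
                 (∃[ f ] ∃[ i ] (0 < toℕ i × toℕ i < len f × vert (path f) i ≡ v))
    inner-not-branch : ∀ f i u → 0 < toℕ i → toℕ i < len f → vert (path f) i ≢ φ u
    inner-disjoint : ∀ f g i j → 0 < toℕ i → toℕ i < len f →
                     0 < toℕ j → toℕ j < len g →
                     vert (path f) i ≡ vert (path g) j → f ≡ g

-- C₃⁺ : triangle on vertices 0,1,2 with edge 01 doubled

C3⁺-ends : Fin 4 → Fin 3 × Fin 3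
C3⁺-ends zero                   = zero , suc zero
C3⁺-ends (suc zero)             = zero , suc zero
C3⁺-ends (suc (suc zero))       = suc zero , suc (suc zero)
C3⁺-ends (suc (suc (suc zero))) = suc (suc zero) , zero

C3⁺-no-loop : ∀ e → proj₁ (C3⁺-ends e) ≢ proj₂ (C3⁺-ends e)
C3⁺-no-loop zero                   ()
C3⁺-no-loop (suc zero)             ()
C3⁺-no-loop (suc (suc zero))       ()
C3⁺-no-loop (suc (suc (suc zero))) ()

C3⁺ : Graph
C3⁺ = record { nV = 3 ; nE = 4 ; ends = C3⁺-ends ; no-loop = C3⁺-no-loop }

IsOddC3⁺Graph : Graph → Set
IsOddC3⁺Graph G = TotallyOddSubdivision G C3⁺

IsOddC3⁺ : ∀ {n} → Matroid n → Set
IsOddC3⁺ M = ∃[ G ] (IsOddC3⁺Graph G × IsoToCycleMatroid M G)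

module Submission where

-- Every inner vertex of a subdivided edge has degree two, so a cycle of an odd-C₃⁺ graph is a union of
-- whole subdivision paths, and of these unions only p₀ ∪ p₁, p₀ ∪ p₂ ∪ p₃ and p₁ ∪ p₂ ∪ p₃ have degree
-- 0 or 2 at the three branch vertices.  Taking C₁ and C₂ to be the last two, |C₁| and |C₂ ─ C₁| = |p₁|
-- are odd because every path has odd length.  Conversely, C₁ ∩ C₂, C₁ ─ C₂ and C₂ ─ C₁ partition the
-- ground set and exactly one of the first two has odd size.  Laying out the two odd parts as p₀ and p₁
-- and the even part (nonempty by minimality of circuits) as p₂ ∪ p₃ gives an odd-C₃⁺ graph whose three
-- cycles are C₁, C₂ and C₁ Δ C₂.

open import Defs
open import Data.Nat using (ℕ; zero; suc; pred; _+_; _∸_; _≤_; _<_; z≤n; s≤s; _<?_; _≤?_; _%_)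
open import Data.Nat.Properties hiding (_≟_)
open import Data.Bool using (Bool; true; false; not; _∧_; _∨_; _xor_)
open import Data.Bool.Properties using (∧-zeroʳ; ∧-identityʳ; xor-same)
open import Data.Fin using (Fin; zero; suc; toℕ; inject₁; fromℕ; fromℕ<; cast; _≟_)
open import Data.Fin.Properties
  using (toℕ-injective; toℕ-inject₁; toℕ-fromℕ; toℕ<n; toℕ-fromℕ<; toℕ-cast; injective⇒≤)
open import Data.Fin.Subset using (Subset; _∈_; _⊆_; _∩_; _∪_; _─_; ⊤; ∣_∣)
open import Data.Vec using (Vec; []; _∷_; lookup; tabulate; zipWith)
open import Data.Vec.Properties
  using (tabulate∘lookup; tabulate-cong; lookup∘tabulate; lookup-zipWith; lookup-replicate; []=⇒lookup; lookup⇒[]=)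
open import Data.Product using (Σ; ∃-syntax; _×_; _,_; proj₁; proj₂)
open import Data.Sum using (_⊎_; inj₁; inj₂)
open import Data.Empty using (⊥; ⊥-elim)
open import Relation.Nullary using (¬_; Dec; yes; no; does)
open import Relation.Nullary.Decidable using (dec-true)
open import Relation.Binary.PropositionalEquality
open import Function.Definitions using (Injective)
open import Function.Bundles using (_⤖_; _⇔_; module Bijection; module Equivalence; mk⇔; mk⤖)
open import Function.Construct.Composition using (_⇔-∘_)

nth : ∀ {A : Set} {k} → (Fin k → A) → A → ℕ → A
nth {k = zero}  f d _       = d
nth {k = suc k} f d zero    = f zero
nth {k = suc k} f d (suc i) = nth (λ t → f (suc t)) d i

nth-toℕ : ∀ {A : Set} {k} (f : Fin k → A) d (t : Fin k) → nth f d (toℕ t) ≡ f t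
nth-toℕ {k = suc k} f d zero    = refl
nth-toℕ {k = suc k} f d (suc t) = nth-toℕ (λ t → f (suc t)) d t

nth-≥ : ∀ {A : Set} {k} (f : Fin k → A) d i → k ≤ i → nth f d i ≡ d
nth-≥ {k = zero}  f d i       _          = refl
nth-≥ {k = suc k} f d (suc i) (s≤s k≤i) = nth-≥ (λ t → f (suc t)) d i k≤i

nth-< : ∀ {A : Set} {k} (f : Fin k → A) d i → i < k → Σ (Fin k) λ t → toℕ t ≡ i × nth f d i ≡ f t
nth-< f d i i<k = fromℕ< i<k , toℕ-fromℕ< i<k ,
  trans (cong (nth f d) (sym (toℕ-fromℕ< i<k))) (nth-toℕ f d _)

InjectiveBelow : ∀ {A : Set} → ℕ → (ℕ → A) → Set
InjectiveBelow n h = ∀ i j → i < n → j < n → h i ≡ h j → i ≡ j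

nth-injective : ∀ {A : Set} {k} (f : Fin k → A) d → Injective _≡_ _≡_ f → InjectiveBelow k (nth f d)
nth-injective f d f-inj i j i<k j<k eq with nth-< f d i i<k | nth-< f d j j<k
... | t , refl , fi≡ | u , refl , fj≡ = cong toℕ (f-inj (trans (sym fi≡) (trans eq fj≡)))

glue : ∀ {A : Set} → ℕ → (ℕ → A) → (ℕ → A) → ℕ → A
glue a f g i with i <? a
... | yes _ = f i
... | no  _ = g (i ∸ a)

glue-< : ∀ {A : Set} a (f g : ℕ → A) i → i < a → glue a f g i ≡ f i
glue-< a f g i i<a with i <? a
... | yes _  = refl
... | no i≮a = ⊥-elim (i≮a i<a)

glue-+ : ∀ {A : Set} a (f g : ℕ → A) j → glue a f g (a + j) ≡ g j
glue-+ a f g j with (a + j) <? a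
... | yes a+j<a = ⊥-elim (<⇒≱ a+j<a (m≤m+n a j))
... | no  _     = cong g (m+n∸m≡n a j)

split-at : ∀ a i → i < a ⊎ Σ ℕ λ j → i ≡ a + j
split-at a i with i <? a
... | yes i<a = inj₁ i<a
... | no  i≮a = inj₂ (i ∸ a , sym (m+[n∸m]≡n (≮⇒≥ i≮a)))

glue-injective : ∀ {A : Set} a b (f g : ℕ → A) → InjectiveBelow a f → InjectiveBelow b g →
                 (∀ i j → i < a → j < b → f i ≢ g j) → InjectiveBelow (a + b) (glue a f g)
glue-injective a b f g f-inj g-inj f≢g i j i< j< eq with split-at a i | split-at a j
... | inj₁ i<a | inj₁ j<a =
  f-inj i j i<a j<a (trans (sym (glue-< a f g i i<a)) (trans eq (glue-< a f g j j<a)))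
... | inj₁ i<a | inj₂ (j' , refl) = ⊥-elim (f≢g i j' i<a (+-cancelˡ-< a j' b j<)
  (trans (sym (glue-< a f g i i<a)) (trans eq (glue-+ a f g j'))))
... | inj₂ (i' , refl) | inj₁ j<a = ⊥-elim (f≢g j i' j<a (+-cancelˡ-< a i' b i<)
  (trans (sym (glue-< a f g j j<a)) (trans (sym eq) (glue-+ a f g i'))))
... | inj₂ (i' , refl) | inj₂ (j' , refl) = cong (a +_) (g-inj i' j' (+-cancelˡ-< a i' b i<) (+-cancelˡ-< a j' b j<)
  (trans (sym (glue-+ a f g i')) (trans eq (glue-+ a f g j'))))

Incident : (G : Graph) → Fin (nE G) → Fin (nV G) → Set
Incident G h w = proj₁ (ends G h) ≡ w ⊎ proj₂ (ends G h) ≡ w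

module GraphFacts (G : Graph) where

  incident-joins : ∀ {h x y w} → Joins G h x y → Incident G h w → w ≡ x ⊎ w ≡ y
  incident-joins (inj₁ eq) (inj₁ p) = inj₁ (trans (sym p) (cong proj₁ eq))
  incident-joins (inj₁ eq) (inj₂ p) = inj₂ (trans (sym p) (cong proj₂ eq))
  incident-joins (inj₂ eq) (inj₁ p) = inj₂ (trans (sym p) (cong proj₁ eq))
  incident-joins (inj₂ eq) (inj₂ p) = inj₁ (trans (sym p) (cong proj₂ eq))

  joins-incidentˡ : ∀ {h x y} → Joins G h x y → Incident G h x
  joins-incidentˡ (inj₁ eq) = inj₁ (cong proj₁ eq)
  joins-incidentˡ (inj₂ eq) = inj₂ (cong proj₂ eq)

  joins-incidentʳ : ∀ {h x y} → Joins G h x y → Incident G h y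
  joins-incidentʳ (inj₁ eq) = inj₂ (cong proj₂ eq)
  joins-incidentʳ (inj₂ eq) = inj₁ (cong proj₁ eq)

  joins-sym : ∀ {h x y} → Joins G h x y → Joins G h y x
  joins-sym (inj₁ eq) = inj₂ eq
  joins-sym (inj₂ eq) = inj₁ eq

  joins-cong : ∀ {h h' x x' y y'} → h ≡ h' → x ≡ x' → y ≡ y' → Joins G h x y → Joins G h' x' y'
  joins-cong refl refl refl j = j

  glue-joins : ∀ a b (fv gv : ℕ → Fin (nV G)) (fe ge : ℕ → Fin (nE G)) →
    (∀ i → i < a → Joins G (fe i) (fv i) (fv (suc i))) → fv a ≡ gv 0 →
    (∀ j → j < b → Joins G (ge j) (gv j) (gv (suc j))) →
    ∀ i → i < a + b → Joins G (glue a fe ge i) (glue a fv gv i) (glue a fv gv (suc i))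
  glue-joins a b fv gv fe ge f-joins fv≡gv g-joins i i< with split-at a i
  ... | inj₂ (j , refl) =
    joins-cong (sym (glue-+ a fe ge j)) (sym (glue-+ a fv gv j))
      (trans (sym (glue-+ a fv gv (suc j))) (cong (glue a fv gv) (+-suc a j)))
      (g-joins j (+-cancelˡ-< a j b i<))
  ... | inj₁ i<a = joins-cong (sym (glue-< a fe ge i i<a)) (sym (glue-< a fv gv i i<a)) next (f-joins i i<a)
    where
    next : fv (suc i) ≡ glue a fv gv (suc i)
    next with m≤n⇒m<n∨m≡n i<a
    ... | inj₁ 1+i<a = sym (glue-< a fv gv (suc i) 1+i<a)
    ... | inj₂ refl  = trans fv≡gv (trans (sym (glue-+ a fv gv 0)) (cong (glue a fv gv) (+-identityʳ a)))

  module PathIndexing {m : ℕ} (P : Path G m) where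

    pv : ℕ → Fin (nV G)
    pv = nth (vert P) (start P)

    pe : Fin (nE G) → ℕ → Fin (nE G)
    pe = nth (edge P)

    pv-injective : ∀ i j → i ≤ m → j ≤ m → pv i ≡ pv j → i ≡ j
    pv-injective i j i≤m j≤m = nth-injective (vert P) _ (vert-inj P) i j (s≤s i≤m) (s≤s j≤m)

    pe-injective : ∀ d → InjectiveBelow m (pe d)
    pe-injective d = nth-injective (edge P) d (edge-inj P)

    pe-joins : ∀ d i → i < m → Joins G (pe d i) (pv i) (pv (suc i))
    pe-joins d i i<m with nth-< (edge P) d i i<m
    ... | t , refl , pe≡ =
      joins-cong (sym pe≡)
        (trans (sym (nth-toℕ (vert P) _ (inject₁ t))) (cong pv (toℕ-inject₁ t)))
        (sym (nth-toℕ (vert P) _ (suc t)))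
        (edge-join P t)

    pv-finish : pv m ≡ finish P
    pv-finish = trans (cong pv (sym (toℕ-fromℕ m))) (nth-toℕ (vert P) _ (fromℕ m))

    pe-toℕ : ∀ d t → pe d (toℕ t) ≡ edge P t
    pe-toℕ d = nth-toℕ (edge P) d

  closedPath⇒IsCycleSet : (D : Subset (nE G)) (L : ℕ) → 2 ≤ L → (v : ℕ → Fin (nV G)) (ed : ℕ → Fin (nE G)) →
    InjectiveBelow L v → InjectiveBelow L ed →
    (∀ i → i < L → Joins G (ed i) (v i) (v (suc i))) → v L ≡ v 0 →
    (∀ h → h ∈ D → Σ ℕ λ i → i < L × ed i ≡ h) →
    (∀ h → (Σ ℕ λ i → i < L × ed i ≡ h) → h ∈ D) → IsCycleSet G D
  closedPath⇒IsCycleSet D (suc (suc k)) (s≤s (s≤s _)) v ed v-inj ed-inj v-joins closed D⊆ ⊆D =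
    k , P , ed (suc k) , last∉P , last-joins , λ f → D→ f , →D f
    where
    P : Path G (suc k)
    P = record
      { vert      = λ t → v (toℕ t)
      ; edge      = λ t → ed (toℕ t)
      ; vert-inj  = λ {x} {y} eq → toℕ-injective (v-inj _ _ (toℕ<n x) (toℕ<n y) eq)
      ; edge-inj  = λ {x} {y} eq → toℕ-injective (ed-inj _ _ (m<n⇒m<1+n (toℕ<n x)) (m<n⇒m<1+n (toℕ<n y)) eq)
      ; edge-join = λ t → joins-cong refl (cong v (sym (toℕ-inject₁ t))) refl (v-joins (toℕ t) (m<n⇒m<1+n (toℕ<n t)))
      }
    last∉P : ∀ i → edge P i ≢ ed (suc k)
    last∉P t eq = <⇒≢ (toℕ<n t) (ed-inj _ _ (m<n⇒m<1+n (toℕ<n t)) ≤-refl eq)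
    last-joins : Joins G (ed (suc k)) (finish P) (start P)
    last-joins = joins-cong refl (cong v (sym (toℕ-fromℕ (suc k)))) closed (v-joins (suc k) ≤-refl)
    D→ : ∀ f → f ∈ D → f ≡ ed (suc k) ⊎ ∃[ i ] edge P i ≡ f
    D→ f f∈D with D⊆ f f∈D
    ... | i , i< , eq with m≤n⇒m<n∨m≡n (≤-pred i<)
    ...   | inj₁ i<1+k = inj₂ (fromℕ< i<1+k , trans (cong ed (toℕ-fromℕ< i<1+k)) eq)
    ...   | inj₂ refl  = inj₁ (sym eq)
    →D : ∀ f → f ≡ ed (suc k) ⊎ ∃[ i ] edge P i ≡ f → f ∈ D
    →D f (inj₁ refl)     = ⊆D f (suc k , ≤-refl , refl)
    →D f (inj₂ (t , eq)) = ⊆D f (toℕ t , m<n⇒m<1+n (toℕ<n t) , eq)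

-- The edges of a cycle are read off cyclically as edge i from vertex i to vertex i + 1, i ≤ L,
-- where edge L is the closing edge back to vertex 0.
module CycleDegree (G : Graph) (D : Subset (nE G)) (cyc : IsCycleSet G D) where

  open GraphFacts G

  private
    k : ℕ
    k = proj₁ cyc
    P : Path G (suc k)
    P = proj₁ (proj₂ cyc)
    closing : Fin (nE G)
    closing = proj₁ (proj₂ (proj₂ cyc))
    closing∉P : ∀ i → edge P i ≢ closing
    closing∉P = proj₁ (proj₂ (proj₂ (proj₂ cyc)))
    closing-joins : Joins G closing (finish P) (start P)
    closing-joins = proj₁ (proj₂ (proj₂ (proj₂ (proj₂ cyc))))
    members : ∀ f → (f ∈ D → (f ≡ closing ⊎ ∃[ i ] edge P i ≡ f)) × ((f ≡ closing ⊎ ∃[ i ] edge P i ≡ f) → f ∈ D)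
    members = proj₂ (proj₂ (proj₂ (proj₂ (proj₂ cyc))))
    L : ℕ
    L = suc k
    open PathIndexing P

    ce : ℕ → Fin (nE G)
    ce = pe closing

    ce-L : ce L ≡ closing
    ce-L = nth-≥ (edge P) closing L ≤-refl

    ce-injective : ∀ i j → i ≤ L → j ≤ L → ce i ≡ ce j → i ≡ j
    ce-injective i j i≤ j≤ eq with m≤n⇒m<n∨m≡n i≤ | m≤n⇒m<n∨m≡n j≤
    ... | inj₁ i< | inj₁ j<    = pe-injective closing i j i< j< eq
    ... | inj₁ i< | inj₂ refl with nth-< (edge P) closing i i<
    ...   | t , _ , ce≡ = ⊥-elim (closing∉P t (trans (sym ce≡) (trans eq ce-L)))
    ce-injective i j i≤ j≤ eq | inj₂ refl | inj₁ j< with nth-< (edge P) closing j j<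
    ...   | t , _ , ce≡ = ⊥-elim (closing∉P t (trans (sym ce≡) (trans (sym eq) ce-L)))
    ce-injective i j i≤ j≤ eq | inj₂ refl | inj₂ refl = refl

    ce-L-joins : Joins G (ce L) (pv L) (pv 0)
    ce-L-joins = joins-cong (sym ce-L) (sym pv-finish) refl closing-joins

    ∈⇒ce : ∀ h → h ∈ D → Σ ℕ λ i → i ≤ L × ce i ≡ h
    ∈⇒ce h h∈D with proj₁ (members h) h∈D
    ... | inj₁ refl     = L , ≤-refl , ce-L
    ... | inj₂ (t , eq) = toℕ t , <⇒≤ (toℕ<n t) , trans (pe-toℕ closing t) eq

    ce∈ : ∀ i → i ≤ L → ce i ∈ D
    ce∈ i i≤ with m≤n⇒m<n∨m≡n i≤
    ... | inj₂ refl = subst (_∈ D) (sym ce-L) (proj₂ (members closing) (inj₁ refl))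
    ... | inj₁ i< with nth-< (edge P) closing i i<
    ...   | t , _ , ce≡ = subst (_∈ D) (sym ce≡) (proj₂ (members (edge P t)) (inj₂ (t , refl)))

    -- the edge entering vertex t; the edge ce t leaves it
    incoming : ℕ → Fin (nE G)
    incoming zero    = ce L
    incoming (suc t) = ce t

    incoming≢ce : ∀ t → t ≤ L → incoming t ≢ ce t
    incoming≢ce zero    t≤ eq with ce-injective L 0 ≤-refl z≤n eq
    ... | ()
    incoming≢ce (suc t) t≤ eq = 1+n≢n (sym (ce-injective t (suc t) (<⇒≤ t≤) t≤ eq))

    ce-incident : ∀ t → t ≤ L → Incident G (ce t) (pv t)
    ce-incident t t≤ with m≤n⇒m<n∨m≡n t≤
    ... | inj₁ t<   = joins-incidentˡ (pe-joins closing t t<)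
    ... | inj₂ refl = joins-incidentˡ ce-L-joins

    incoming-incident : ∀ t → t ≤ L → Incident G (incoming t) (pv t)
    incoming-incident zero    _  = joins-incidentʳ ce-L-joins
    incoming-incident (suc t) t≤ = joins-incidentʳ (pe-joins closing t t≤)

    incoming∈ : ∀ t → t ≤ L → incoming t ∈ D
    incoming∈ zero    _  = ce∈ L ≤-refl
    incoming∈ (suc t) t≤ = ce∈ t (<⇒≤ t≤)

    ce-ends : ∀ i w → i ≤ L → Incident G (ce i) w → Σ ℕ λ t → t ≤ L × w ≡ pv t
    ce-ends i w i≤ inc with m≤n⇒m<n∨m≡n i≤
    ... | inj₁ i< with incident-joins (pe-joins closing i i<) inc
    ...   | inj₁ q = i , i≤ , q
    ...   | inj₂ q = suc i , i< , q
    ce-ends i w i≤ inc | inj₂ refl with incident-joins ce-L-joins inc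
    ...   | inj₁ q = L , ≤-refl , q
    ...   | inj₂ q = 0 , z≤n , q

    ce-at : ∀ i t → i ≤ L → t ≤ L → Incident G (ce i) (pv t) → ce i ≡ incoming t ⊎ ce i ≡ ce t
    ce-at i t i≤ t≤ inc with m≤n⇒m<n∨m≡n i≤
    ... | inj₁ i< with incident-joins (pe-joins closing i i<) inc
    ...   | inj₁ q = inj₂ (cong ce (sym (pv-injective t i t≤ i≤ q)))
    ...   | inj₂ q with pv-injective t (suc i) t≤ i< q
    ...     | refl = inj₁ refl
    ce-at i t i≤ t≤ inc | inj₂ refl with incident-joins ce-L-joins inc
    ...   | inj₁ q = inj₂ (cong ce (sym (pv-injective t L t≤ ≤-refl q)))
    ...   | inj₂ q with pv-injective t 0 t≤ z≤n q
    ...     | refl = inj₁ refl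

    cycle-edges-at : ∀ t → t ≤ L → ∀ h → h ∈ D → Incident G h (pv t) → h ≡ incoming t ⊎ h ≡ ce t
    cycle-edges-at t t≤ h h∈D inc with ∈⇒ce h h∈D
    ... | i , i≤ , refl = ce-at i t i≤ t≤ inc

  cycle-nonempty : Σ (Fin (nE G)) (_∈ D)
  cycle-nonempty = ce L , ce∈ L ≤-refl

  cycle-degree-two : ∀ g w → g ∈ D → Incident G g w →
    Σ (Fin (nE G)) λ g' → g' ∈ D × g' ≢ g × Incident G g' w × (∀ h → h ∈ D → Incident G h w → h ≡ g ⊎ h ≡ g')
  cycle-degree-two g w g∈D inc with ∈⇒ce g g∈D
  ... | i , i≤ , refl with ce-ends i w i≤ inc
  ...   | t , t≤ , refl with cycle-edges-at t t≤ (ce i) g∈D inc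
  ...     | inj₁ q = ce t , ce∈ t t≤ , (λ z → incoming≢ce t t≤ (trans (sym q) (sym z))) , ce-incident t t≤ ,
                     λ h h∈D inc' → Data.Sum.map₁ (λ z → trans z (sym q)) (cycle-edges-at t t≤ h h∈D inc')
  ...     | inj₂ q = incoming t , incoming∈ t t≤ , (λ z → incoming≢ce t t≤ (trans z q)) , incoming-incident t t≤ ,
                     λ h h∈D inc' → Data.Sum.swap (Data.Sum.map₂ (λ z → trans z (sym q)) (cycle-edges-at t t≤ h h∈D inc'))

boundary-or-inner : ∀ j m → j ≤ m → j ≡ 0 ⊎ j ≡ m ⊎ (0 < j × j < m)
boundary-or-inner zero    m _   = inj₁ refl
boundary-or-inner (suc j) m j<m with m≤n⇒m<n∨m≡n j<m
... | inj₁ 1+j<m = inj₂ (inj₂ (s≤s z≤n , 1+j<m))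
... | inj₂ 1+j≡m = inj₂ (inj₁ 1+j≡m)

Odd⇒suc : ∀ n → Odd n → Σ ℕ λ l → n ≡ suc l
Odd⇒suc (suc l) _ = l , refl

source target : Fin 4 → Fin 3
source f = proj₁ (C3⁺-ends f)
target f = proj₂ (C3⁺-ends f)

-- Path f of the subdivision is indexed by ℕ: vertex i is pv f i (i ≤ len f), edge i is pe f i (i < len f).
module Subdivision (G : Graph) (T : TotallyOddSubdivision G C3⁺) where

  open TotallyOddSubdivision T
  open GraphFacts G

  len-suc : ∀ f → Σ ℕ λ l → len f ≡ suc l
  len-suc f = Odd⇒suc (len f) (len-odd f)

  0<len : ∀ f → 0 < len f
  0<len f with len-suc f
  ... | l , eq = subst (0 <_) (sym eq) (s≤s z≤n)

  private
    -- junk value for out-of-range edge indices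
    some-edge : Fin (nE G)
    some-edge = edge (path zero) (subst Fin (sym (proj₂ (len-suc zero))) zero)

  pv : Fin 4 → ℕ → Fin (nV G)
  pv f = PathIndexing.pv (path f)

  pe : Fin 4 → ℕ → Fin (nE G)
  pe f = PathIndexing.pe (path f) some-edge

  pv-0 : ∀ f → pv f 0 ≡ φ (source f)
  pv-0 = path-start

  pv-len : ∀ f → pv f (len f) ≡ φ (target f)
  pv-len f = trans (PathIndexing.pv-finish (path f)) (path-finish f)

  pe-joins : ∀ f i → i < len f → Joins G (pe f i) (pv f i) (pv f (suc i))
  pe-joins f = PathIndexing.pe-joins (path f) some-edge

  pv-injective : ∀ f i j → i ≤ len f → j ≤ len f → pv f i ≡ pv f j → i ≡ j
  pv-injective f = PathIndexing.pv-injective (path f)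

  pe-unique : ∀ f g i j → i < len f → j < len g → pe f i ≡ pe g j → f ≡ g × i ≡ j
  pe-unique f g i j i< j< eq with nth-< (edge (path f)) some-edge i i< | nth-< (edge (path g)) some-edge j j<
  ... | a , refl , pe≡a | b , refl , pe≡b with edge-uniq f g a b (trans (sym pe≡a) (trans eq pe≡b))
  ...   | f≡g , a≡b = f≡g , a≡b

  pe-disjoint : ∀ f g i j → f ≢ g → i < len f → j < len g → pe f i ≢ pe g j
  pe-disjoint f g i j f≢g i< j< eq = f≢g (proj₁ (pe-unique f g i j i< j< eq))

  owner : Fin (nE G) → Fin 4
  owner h = proj₁ (edge-cover h)

  position : Fin (nE G) → ℕ
  position h = toℕ (proj₁ (proj₂ (edge-cover h)))

  position< : ∀ h → position h < len (owner h)
  position< h = toℕ<n _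

  pe-position : ∀ h → pe (owner h) (position h) ≡ h
  pe-position h = trans (PathIndexing.pe-toℕ (path (owner h)) some-edge _) (proj₂ (proj₂ (edge-cover h)))

  owner-pe : ∀ f j → j < len f → owner (pe f j) ≡ f
  owner-pe f j j< = proj₁ (pe-unique (owner (pe f j)) f (position (pe f j)) j (position< _) j< (pe-position (pe f j)))

  owned⇒pe : ∀ h f → owner h ≡ f → Σ ℕ λ j → j < len f × pe f j ≡ h
  owned⇒pe h f refl = position h , position< h , pe-position h

  private
    vertex-index : ∀ f i → i ≤ len f → Σ (Fin (suc (len f))) λ a → toℕ a ≡ i × pv f i ≡ vert (path f) a
    vertex-index f i i≤ = nth-< (vert (path f)) _ i (s≤s i≤)

  inner≢branch : ∀ f i u → 0 < i → i < len f → pv f i ≢ φ u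
  inner≢branch f i u 0<i i< eq with vertex-index f i (<⇒≤ i<)
  ... | a , refl , pv≡a = inner-not-branch f a u 0<i i< (trans (sym pv≡a) eq)

  inner-unique : ∀ f g i j → 0 < i → i < len f → j ≤ len g → pv f i ≡ pv g j → f ≡ g × i ≡ j
  inner-unique f g i j 0<i i< j≤ eq with boundary-or-inner j (len g) j≤
  ... | inj₁ refl        = ⊥-elim (inner≢branch f i (source g) 0<i i< (trans eq (pv-0 g)))
  ... | inj₂ (inj₁ refl) = ⊥-elim (inner≢branch f i (target g) 0<i i< (trans eq (pv-len g)))
  ... | inj₂ (inj₂ (0<j , j<)) with vertex-index f i (<⇒≤ i<) | vertex-index g j j≤
  ...   | a , refl , pv≡a | b , refl , pv≡b with inner-disjoint f g a b 0<i i< 0<j j< (trans (sym pv≡a) (trans eq pv≡b))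
  ...     | refl = refl , pv-injective f i j (<⇒≤ i<) j≤ eq

  edges-at-inner : ∀ f i → suc i < len f → ∀ h → Incident G h (pv f (suc i)) → h ≡ pe f i ⊎ h ≡ pe f (suc i)
  edges-at-inner f i i< h inc
    with incident-joins (pe-joins (owner h) (position h) (position< h))
           (subst (λ z → Incident G z (pv f (suc i))) (sym (pe-position h)) inc)
  ... | inj₁ q with inner-unique f (owner h) (suc i) (position h) (s≤s z≤n) i< (<⇒≤ (position< h)) q
  ...   | refl , eq = inj₂ (trans (sym (pe-position h)) (cong (pe f) (sym eq)))
  edges-at-inner f i i< h inc | inj₂ q with inner-unique f (owner h) (suc i) (suc (position h)) (s≤s z≤n) i< (position< h) q
  ...   | refl , eq = inj₁ (trans (sym (pe-position h)) (cong (pe f) (sym (suc-injective eq))))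

  branch-position : ∀ f j u → j ≤ len f → pv f j ≡ φ u → (j ≡ 0 × source f ≡ u) ⊎ (j ≡ len f × target f ≡ u)
  branch-position f j u j≤ eq with boundary-or-inner j (len f) j≤
  ... | inj₁ refl              = inj₁ (refl , φ-inj (trans (sym (pv-0 f)) eq))
  ... | inj₂ (inj₁ refl)       = inj₂ (refl , φ-inj (trans (sym (pv-len f)) eq))
  ... | inj₂ (inj₂ (0<j , j<)) = ⊥-elim (inner≢branch f j u 0<j j< eq)

  last : Fin 4 → ℕ
  last f = pred (len f)

  suc-last : ∀ f → suc (last f) ≡ len f
  suc-last f with len-suc f
  ... | l , eq rewrite eq = refl

  last< : ∀ f → last f < len f
  last< f = subst (last f <_) (suc-last f) ≤-refl

  edges-at-branch : ∀ u h → Incident G h (φ u) →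
    Σ (Fin 4) λ f → (h ≡ pe f 0 × source f ≡ u) ⊎ (h ≡ pe f (last f) × target f ≡ u)
  edges-at-branch u h inc
    with incident-joins (pe-joins (owner h) (position h) (position< h))
           (subst (λ z → Incident G z (φ u)) (sym (pe-position h)) inc)
  ... | inj₁ q with branch-position (owner h) (position h) u (<⇒≤ (position< h)) (sym q)
  ...   | inj₁ (eq , su) = owner h , inj₁ (trans (sym (pe-position h)) (cong (pe (owner h)) eq) , su)
  ...   | inj₂ (eq , _)  = ⊥-elim (<⇒≢ (position< h) eq)
  edges-at-branch u h inc | inj₂ q with branch-position (owner h) (suc (position h)) u (position< h) (sym q)
  ...   | inj₁ (() , _)
  ...   | inj₂ (eq , tu) = owner h , inj₂ (trans (sym (pe-position h))
            (cong (pe (owner h)) (suc-injective (trans eq (sym (suc-last (owner h)))))) , tu)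

  first-incident : ∀ f → Incident G (pe f 0) (φ (source f))
  first-incident f = subst (Incident G (pe f 0)) (pv-0 f) (joins-incidentˡ (pe-joins f 0 (0<len f)))

  last-incident : ∀ f → Incident G (pe f (last f)) (φ (target f))
  last-incident f = subst (Incident G (pe f (last f))) (trans (cong (pv f) (suc-last f)) (pv-len f))
                      (joins-incidentʳ (pe-joins f (last f) (last< f)))

pattern p₀ = zero
pattern p₁ = suc zero
pattern p₂ = suc (suc zero)
pattern p₃ = suc (suc (suc zero))

pattern b₀ = zero
pattern b₁ = suc zero
pattern b₂ = suc (suc zero)

paths01 paths023 paths123 : Fin 4 → Bool
paths01 p₀ = true
paths01 p₁ = true
paths01 _  = false
paths023 p₁ = false
paths023 _  = true
paths123 p₀ = false
paths123 _  = true

module PathUnion (G : Graph) (T : TotallyOddSubdivision G C3⁺) where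

  open TotallyOddSubdivision T using (len)
  open Subdivision G T

  pathUnion : (Fin 4 → Bool) → Subset (nE G)
  pathUnion S = tabulate λ h → S (owner h)

  ∈pathUnion⇒ : ∀ S h → h ∈ pathUnion S → S (owner h) ≡ true
  ∈pathUnion⇒ S h h∈ = trans (sym (lookup∘tabulate _ h)) ([]=⇒lookup h∈)

  pe∈pathUnion : ∀ S f j → j < len f → S f ≡ true → pe f j ∈ pathUnion S
  pe∈pathUnion S f j j< Sf = lookup⇒[]= _ (pathUnion S)
    (trans (lookup∘tabulate _ (pe f j)) (trans (cong S (owner-pe f j j<)) Sf))

-- A cycle through an inner vertex uses both path edges there, so it is a union of whole paths;
-- among those unions only the three even subgraphs of C₃⁺ have all degrees 0 or 2.
module CycleClassification (G : Graph) (T : TotallyOddSubdivision G C3⁺) (D : Subset (nE G)) (cyc : IsCycleSet G D) where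

  open TotallyOddSubdivision T
  open GraphFacts G
  open Subdivision G T
  open PathUnion G T
  open CycleDegree G D cyc

  private
    step-up : ∀ f i → suc i < len f → pe f i ∈ D → pe f (suc i) ∈ D
    step-up f i i< pe∈ with cycle-degree-two (pe f i) (pv f (suc i)) pe∈ (joins-incidentʳ (pe-joins f i (<⇒≤ i<)))
    ... | g' , g'∈ , g'≢ , inc' , _ with edges-at-inner f i i< g' inc'
    ...   | inj₁ q = ⊥-elim (g'≢ q)
    ...   | inj₂ q = subst (_∈ D) q g'∈

    step-down : ∀ f i → suc i < len f → pe f (suc i) ∈ D → pe f i ∈ D
    step-down f i i< pe∈ with cycle-degree-two (pe f (suc i)) (pv f (suc i)) pe∈ (joins-incidentˡ (pe-joins f (suc i) i<))
    ... | g' , g'∈ , g'≢ , inc' , _ with edges-at-inner f i i< g' inc'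
    ...   | inj₁ q = subst (_∈ D) q g'∈
    ...   | inj₂ q = ⊥-elim (g'≢ q)

    pe∈⇒first∈ : ∀ f i → i < len f → pe f i ∈ D → pe f 0 ∈ D
    pe∈⇒first∈ f zero    _  pe∈ = pe∈
    pe∈⇒first∈ f (suc i) i< pe∈ = pe∈⇒first∈ f i (<⇒≤ i<) (step-down f i i< pe∈)

    first∈⇒pe∈ : ∀ f i → i < len f → pe f 0 ∈ D → pe f i ∈ D
    first∈⇒pe∈ f zero    _  first∈ = first∈
    first∈⇒pe∈ f (suc i) i< first∈ = step-up f i i< (first∈⇒pe∈ f i (<⇒≤ i<) first∈)

    selected : Fin 4 → Bool
    selected f = lookup D (pe f 0)

    selected⇒pe∈ : ∀ f → selected f ≡ true → ∀ i → i < len f → pe f i ∈ D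
    selected⇒pe∈ f sel i i< = first∈⇒pe∈ f i i< (lookup⇒[]= (pe f 0) D sel)

    pe∈⇒selected : ∀ f i → i < len f → pe f i ∈ D → selected f ≡ true
    pe∈⇒selected f i i< pe∈ = []=⇒lookup (pe∈⇒first∈ f i i< pe∈)

    lookup≡selected-owner : ∀ h → lookup D h ≡ selected (owner h)
    lookup≡selected-owner h with lookup D h in eq | selected (owner h) in sel
    ... | true  | true  = refl
    ... | false | false = refl
    ... | true  | false with trans (sym (pe∈⇒selected (owner h) (position h) (position< h)
                                (subst (_∈ D) (sym (pe-position h)) (lookup⇒[]= h D eq)))) sel
    ...   | ()
    lookup≡selected-owner h | false | true
      with trans (sym ([]=⇒lookup (subst (_∈ D) (pe-position h) (selected⇒pe∈ (owner h) sel (position h) (position< h))))) eq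
    ...   | ()

    ≡pathUnion : ∀ S → (∀ f → selected f ≡ S f) → D ≡ pathUnion S
    ≡pathUnion S sel≡S = trans (sym (tabulate∘lookup D)) (tabulate-cong λ h → trans (lookup≡selected-owner h) (sel≡S (owner h)))

    first∈ : ∀ f → selected f ≡ true → pe f 0 ∈ D
    first∈ f sel = selected⇒pe∈ f sel 0 (0<len f)

    last∈ : ∀ f → selected f ≡ true → pe f (last f) ∈ D
    last∈ f sel = selected⇒pe∈ f sel (last f) (last< f)

    -- degree one at φ u: g is the only cycle edge there belonging to a selected path
    no-degree-one : ∀ u g → g ∈ D → Incident G g (φ u) →
      (∀ f → selected f ≡ true → (source f ≡ u → pe f 0 ≡ g) × (target f ≡ u → pe f (last f) ≡ g)) → ⊥
    no-degree-one u g g∈ inc only-g with cycle-degree-two g (φ u) g∈ inc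
    ... | g' , g'∈ , g'≢ , inc' , _ with edges-at-branch u g' inc'
    ...   | f , inj₁ (q , su) = g'≢ (trans q (proj₁ (only-g f (pe∈⇒selected f 0 (0<len f) (subst (_∈ D) q g'∈))) su))
    ...   | f , inj₂ (q , tu) = g'≢ (trans q (proj₂ (only-g f (pe∈⇒selected f (last f) (last< f) (subst (_∈ D) q g'∈))) tu))

    no-degree-three : ∀ w g₁ g₂ g₃ → g₁ ∈ D → g₂ ∈ D → g₃ ∈ D → Incident G g₁ w → Incident G g₂ w → Incident G g₃ w →
                      g₁ ≢ g₂ → g₁ ≢ g₃ → g₂ ≢ g₃ → ⊥
    no-degree-three w g₁ g₂ g₃ g₁∈ g₂∈ g₃∈ inc₁ inc₂ inc₃ g₁≢g₂ g₁≢g₃ g₂≢g₃ with cycle-degree-two g₁ w g₁∈ inc₁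
    ... | _ , _ , _ , _ , at-w with at-w g₂ g₂∈ inc₂ | at-w g₃ g₃∈ inc₃
    ...   | inj₁ q  | _       = g₁≢g₂ (sym q)
    ...   | inj₂ _  | inj₁ q  = g₁≢g₃ (sym q)
    ...   | inj₂ q₂ | inj₂ q₃ = g₂≢g₃ (trans q₂ (sym q₃))

    -- the three paths at φ b₀ are p₀ and p₁ (leaving it) and p₃ (entering it)
    no-degree-three-at-b₀ : selected p₀ ≡ true → selected p₁ ≡ true → selected p₃ ≡ true → ⊥
    no-degree-three-at-b₀ s₀ s₁ s₃ = no-degree-three (φ b₀) (pe p₀ 0) (pe p₁ 0) (pe p₃ (last p₃))
      (first∈ p₀ s₀) (first∈ p₁ s₁) (last∈ p₃ s₃) (first-incident p₀) (first-incident p₁) (last-incident p₃)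
      (pe-disjoint p₀ p₁ _ _ (λ ()) (0<len p₀) (0<len p₁))
      (pe-disjoint p₀ p₃ _ _ (λ ()) (0<len p₀) (last< p₃))
      (pe-disjoint p₁ p₃ _ _ (λ ()) (0<len p₁) (last< p₃))

    no-degree-three-at-b₁ : selected p₀ ≡ true → selected p₁ ≡ true → selected p₂ ≡ true → ⊥
    no-degree-three-at-b₁ s₀ s₁ s₂ = no-degree-three (φ b₁) (pe p₀ (last p₀)) (pe p₁ (last p₁)) (pe p₂ 0)
      (last∈ p₀ s₀) (last∈ p₁ s₁) (first∈ p₂ s₂) (last-incident p₀) (last-incident p₁) (first-incident p₂)
      (pe-disjoint p₀ p₁ _ _ (λ ()) (last< p₀) (last< p₁))
      (pe-disjoint p₀ p₂ _ _ (λ ()) (last< p₀) (0<len p₂))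
      (pe-disjoint p₁ p₂ _ _ (λ ()) (last< p₁) (0<len p₂))

    selected-contradiction : ∀ {f} → selected f ≡ false → selected f ≡ true → ∀ {A : Set} → A
    selected-contradiction f-false f-true with trans (sym f-false) f-true
    ... | ()

    nothing-selected : ¬ (∀ f → selected f ≡ false)
    nothing-selected none with cycle-nonempty
    ... | h , h∈ = selected-contradiction (none (owner h)) (trans (sym (lookup≡selected-owner h)) ([]=⇒lookup h∈))

  cycle-classification : D ≡ pathUnion paths01 ⊎ D ≡ pathUnion paths023 ⊎ D ≡ pathUnion paths123
  cycle-classification with selected p₀ in s₀ | selected p₁ in s₁ | selected p₂ in s₂ | selected p₃ in s₃
  ... | true  | true  | false | false = inj₁ (≡pathUnion paths01 λ { p₀ → s₀ ; p₁ → s₁ ; p₂ → s₂ ; p₃ → s₃ })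
  ... | true  | false | true  | true  = inj₂ (inj₁ (≡pathUnion paths023 λ { p₀ → s₀ ; p₁ → s₁ ; p₂ → s₂ ; p₃ → s₃ }))
  ... | false | true  | true  | true  = inj₂ (inj₂ (≡pathUnion paths123 λ { p₀ → s₀ ; p₁ → s₁ ; p₂ → s₂ ; p₃ → s₃ }))
  ... | false | false | false | false = ⊥-elim (nothing-selected λ { p₀ → s₀ ; p₁ → s₁ ; p₂ → s₂ ; p₃ → s₃ })
  ... | true  | true  | true  | _     = ⊥-elim (no-degree-three-at-b₁ s₀ s₁ s₂)
  ... | true  | true  | false | true  = ⊥-elim (no-degree-three-at-b₀ s₀ s₁ s₃)
  ... | true  | false | false | false = ⊥-elim (no-degree-one b₀ (pe p₀ 0) (first∈ p₀ s₀) (first-incident p₀)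
        λ { p₀ _ → (λ _ → refl) , (λ ()) ; p₁ x → selected-contradiction s₁ x ; p₂ x → selected-contradiction s₂ x ; p₃ x → selected-contradiction s₃ x })
  ... | false | true  | false | false = ⊥-elim (no-degree-one b₀ (pe p₁ 0) (first∈ p₁ s₁) (first-incident p₁)
        λ { p₀ x → selected-contradiction s₀ x ; p₁ _ → (λ _ → refl) , (λ ()) ; p₂ x → selected-contradiction s₂ x ; p₃ x → selected-contradiction s₃ x })
  ... | false | false | true  | false = ⊥-elim (no-degree-one b₂ (pe p₂ (last p₂)) (last∈ p₂ s₂) (last-incident p₂)
        λ { p₀ x → selected-contradiction s₀ x ; p₁ x → selected-contradiction s₁ x ; p₂ _ → (λ ()) , (λ _ → refl) ; p₃ x → selected-contradiction s₃ x })
  ... | false | false | false | true  = ⊥-elim (no-degree-one b₂ (pe p₃ 0) (first∈ p₃ s₃) (first-incident p₃)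
        λ { p₀ x → selected-contradiction s₀ x ; p₁ x → selected-contradiction s₁ x ; p₂ x → selected-contradiction s₂ x ; p₃ _ → (λ _ → refl) , (λ ()) })
  ... | true  | false | true  | false = ⊥-elim (no-degree-one b₀ (pe p₀ 0) (first∈ p₀ s₀) (first-incident p₀)
        λ { p₀ _ → (λ _ → refl) , (λ ()) ; p₁ x → selected-contradiction s₁ x ; p₂ _ → (λ ()) , (λ ()) ; p₃ x → selected-contradiction s₃ x })
  ... | true  | false | false | true  = ⊥-elim (no-degree-one b₁ (pe p₀ (last p₀)) (last∈ p₀ s₀) (last-incident p₀)
        λ { p₀ _ → (λ ()) , (λ _ → refl) ; p₁ x → selected-contradiction s₁ x ; p₂ x → selected-contradiction s₂ x ; p₃ _ → (λ ()) , (λ ()) })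
  ... | false | true  | true  | false = ⊥-elim (no-degree-one b₀ (pe p₁ 0) (first∈ p₁ s₁) (first-incident p₁)
        λ { p₀ x → selected-contradiction s₀ x ; p₁ _ → (λ _ → refl) , (λ ()) ; p₂ _ → (λ ()) , (λ ()) ; p₃ x → selected-contradiction s₃ x })
  ... | false | true  | false | true  = ⊥-elim (no-degree-one b₁ (pe p₁ (last p₁)) (last∈ p₁ s₁) (last-incident p₁)
        λ { p₀ x → selected-contradiction s₀ x ; p₁ _ → (λ ()) , (λ _ → refl) ; p₂ x → selected-contradiction s₂ x ; p₃ _ → (λ ()) , (λ ()) })
  ... | false | false | true  | true  = ⊥-elim (no-degree-one b₀ (pe p₃ (last p₃)) (last∈ p₃ s₃) (last-incident p₃)
        λ { p₀ x → selected-contradiction s₀ x ; p₁ x → selected-contradiction s₁ x ; p₂ _ → (λ ()) , (λ ()) ; p₃ _ → (λ ()) , (λ _ → refl) })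

m∸1+n<m : ∀ {m n} → n < m → m ∸ suc n < m
m∸1+n<m n<m = ∸-monoʳ-< (s≤s z≤n) n<m

m∸1+[m∸1+n]≡n : ∀ {m n} → n < m → m ∸ suc (m ∸ suc n) ≡ n
m∸1+[m∸1+n]≡n {suc m} (s≤s n≤m) = m∸[m∸n]≡n n≤m

2≤m+n : ∀ {m n} → 0 < m → 0 < n → 2 ≤ m + n
2≤m+n {suc m} {suc n} _ _ = s≤s (subst (1 ≤_) (sym (+-suc m n)) (s≤s z≤n))

module SubdivisionCycles (G : Graph) (T : TotallyOddSubdivision G C3⁺) where

  open TotallyOddSubdivision T
  open GraphFacts G
  open Subdivision G T
  open PathUnion G T

  private
    pv-injectiveBelow : ∀ f → InjectiveBelow (len f) (pv f)
    pv-injectiveBelow f i j i< j< = pv-injective f i j (<⇒≤ i<) (<⇒≤ j<)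

    pe-injectiveBelow : ∀ f → InjectiveBelow (len f) (pe f)
    pe-injectiveBelow f i j i< j< eq = proj₂ (pe-unique f f i j i< j< eq)

    shared-vertex : ∀ f g i j → f ≢ g → i ≤ len f → j ≤ len g → pv f i ≡ pv g j →
      Σ (Fin 3) λ u → ((i ≡ 0 × source f ≡ u) ⊎ (i ≡ len f × target f ≡ u))
                    × ((j ≡ 0 × source g ≡ u) ⊎ (j ≡ len g × target g ≡ u))
    shared-vertex f g i j f≢g i≤ j≤ eq with boundary-or-inner i (len f) i≤
    ... | inj₁ refl        = source f , inj₁ (refl , refl) , branch-position g j (source f) j≤ (trans (sym eq) (pv-0 f))
    ... | inj₂ (inj₁ refl) = target f , inj₂ (refl , refl) , branch-position g j (target f) j≤ (trans (sym eq) (pv-len f))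
    ... | inj₂ (inj₂ (0<i , i<)) = ⊥-elim (f≢g (proj₁ (inner-unique f g i j 0<i i< j≤ eq)))

    pv-disjoint : ∀ f g i j → f ≢ g → source f ≢ source g → i < len f → j < len g → pv f i ≢ pv g j
    pv-disjoint f g i j f≢g sf≢sg i< j< eq with shared-vertex f g i j f≢g (<⇒≤ i<) (<⇒≤ j<) eq
    ... | u , inj₂ (q , _) , _ = <⇒≢ i< q
    ... | u , _ , inj₂ (q , _) = <⇒≢ j< q
    ... | u , inj₁ (_ , p) , inj₁ (_ , q) = sf≢sg (trans p (sym q))

    pv-disjoint-rev : ∀ f g i j → f ≢ g → source f ≢ target g → i < len f → 0 < j → j ≤ len g → pv f i ≢ pv g j
    pv-disjoint-rev f g i j f≢g sf≢tg i< 0<j j≤ eq with shared-vertex f g i j f≢g (<⇒≤ i<) j≤ eq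
    ... | u , inj₂ (q , _) , _ = <⇒≢ i< q
    ... | u , _ , inj₁ (refl , _) = <⇒≢ 0<j refl
    ... | u , inj₁ (_ , p) , inj₂ (_ , q) = sf≢tg (trans p (sym q))

    rev-pv : Fin 4 → ℕ → Fin (nV G)
    rev-pv f j = pv f (len f ∸ j)

    rev-pe : Fin 4 → ℕ → Fin (nE G)
    rev-pe f j = pe f (len f ∸ suc j)

    rev-pv-injective : ∀ f → InjectiveBelow (len f) (rev-pv f)
    rev-pv-injective f i j i< j< eq = ∸-cancelˡ-≡ (<⇒≤ i<) (<⇒≤ j<)
      (pv-injective f _ _ (m∸n≤m (len f) i) (m∸n≤m (len f) j) eq)

    rev-pe-injective : ∀ f → InjectiveBelow (len f) (rev-pe f)
    rev-pe-injective f i j i< j< eq = suc-injective (∸-cancelˡ-≡ i< j<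
      (proj₂ (pe-unique f f _ _ (m∸1+n<m i<) (m∸1+n<m j<) eq)))

    rev-pe-joins : ∀ f j → j < len f → Joins G (rev-pe f j) (rev-pv f j) (rev-pv f (suc j))
    rev-pe-joins f j j< = joins-sym (joins-cong refl refl (cong (pv f) (sym (+-∸-assoc 1 j<)))
                            (pe-joins f (len f ∸ suc j) (m∸1+n<m j<)))

  -- p₀ followed by p₁ traversed backwards
  paths01-cycle : IsCycleSet G (pathUnion paths01)
  paths01-cycle = closedPath⇒IsCycleSet (pathUnion paths01) (a + b) (2≤m+n (0<len p₀) (0<len p₁)) v e
    (glue-injective a b _ _ (pv-injectiveBelow p₀) (rev-pv-injective p₁)
      (λ i j i< j< → pv-disjoint-rev p₀ p₁ i (b ∸ j) (λ ()) (λ ()) i< (m<n⇒0<n∸m j<) (m∸n≤m b j)))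
    (glue-injective a b _ _ (pe-injectiveBelow p₀) (rev-pe-injective p₁)
      (λ i j i< j< → pe-disjoint p₀ p₁ i (b ∸ suc j) (λ ()) i< (m∸1+n<m j<)))
    (glue-joins a b _ _ _ _ (pe-joins p₀) (trans (pv-len p₀) (sym (pv-len p₁))) (rev-pe-joins p₁))
    (trans (glue-+ a (pv p₀) (rev-pv p₁) b)
      (trans (cong (pv p₁) (n∸n≡0 b))
        (trans (pv-0 p₁) (trans (sym (pv-0 p₀)) (sym (glue-< a (pv p₀) (rev-pv p₁) 0 (0<len p₀)))))))
    covered within
    where
    a b : ℕ
    a = len p₀
    b = len p₁
    v : ℕ → Fin (nV G)
    v = glue a (pv p₀) (rev-pv p₁)
    e : ℕ → Fin (nE G)
    e = glue a (pe p₀) (rev-pe p₁)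
    covered : ∀ h → h ∈ pathUnion paths01 → Σ ℕ λ i → i < a + b × e i ≡ h
    covered h h∈ = by-owner (owner h) refl
      where
      by-owner : ∀ f → owner h ≡ f → Σ ℕ λ i → i < a + b × e i ≡ h
      by-owner p₀ o with owned⇒pe h p₀ o
      ... | j , j< , eq = j , ≤-trans j< (m≤m+n a b) , trans (glue-< a _ _ j j<) eq
      by-owner p₁ o with owned⇒pe h p₁ o
      ... | j , j< , eq = a + (b ∸ suc j) , +-monoʳ-< a (m∸1+n<m j<) ,
                          trans (glue-+ a _ _ _) (trans (cong (pe p₁) (m∸1+[m∸1+n]≡n j<)) eq)
      by-owner (suc (suc f)) o with trans (sym (cong paths01 o)) (∈pathUnion⇒ paths01 h h∈)
      ... | ()
    within : ∀ h → (Σ ℕ λ i → i < a + b × e i ≡ h) → h ∈ pathUnion paths01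
    within h (i , i< , eq) with split-at a i
    ... | inj₁ i<a = subst (_∈ pathUnion paths01) (trans (sym (glue-< a _ _ i i<a)) eq)
                       (pe∈pathUnion paths01 p₀ i i<a refl)
    ... | inj₂ (j , refl) = subst (_∈ pathUnion paths01) (trans (sym (glue-+ a _ _ j)) eq)
                              (pe∈pathUnion paths01 p₁ _ (m∸1+n<m (+-cancelˡ-< a j b i<)) refl)

  -- pₓ followed by p₂ and p₃, for x = p₀ or p₁
  module Through-p₂p₃ (x : Fin 4) (S : Fin 4 → Bool) (sx : source x ≡ b₀) (tx : target x ≡ b₁)
      (x≢p₂ : x ≢ p₂) (x≢p₃ : x ≢ p₃) (Sx : S x ≡ true) (S₂ : S p₂ ≡ true) (S₃ : S p₃ ≡ true)
      (S⊆ : ∀ f → S f ≡ true → f ≡ x ⊎ f ≡ p₂ ⊎ f ≡ p₃) where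

    ax c₂ c₃ : ℕ
    ax = len x
    c₂ = len p₂
    c₃ = len p₃

    v₂₃ : ℕ → Fin (nV G)
    v₂₃ = glue c₂ (pv p₂) (pv p₃)
    e₂₃ : ℕ → Fin (nE G)
    e₂₃ = glue c₂ (pe p₂) (pe p₃)
    v : ℕ → Fin (nV G)
    v = glue ax (pv x) v₂₃
    e : ℕ → Fin (nE G)
    e = glue ax (pe x) e₂₃

    sx≢s : ∀ f → source f ≢ b₀ → source x ≢ source f
    sx≢s f sf≢b₀ eq = sf≢b₀ (trans (sym eq) sx)

    v-disjoint : ∀ i j → i < ax → j < c₂ + c₃ → pv x i ≢ v₂₃ j
    v-disjoint i j i< j< eq with split-at c₂ j
    ... | inj₁ j<c₂ = pv-disjoint x p₂ i j x≢p₂ (sx≢s p₂ (λ ())) i< j<c₂ (trans eq (glue-< c₂ _ _ j j<c₂))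
    ... | inj₂ (j' , refl) = pv-disjoint x p₃ i j' x≢p₃ (sx≢s p₃ (λ ())) i< (+-cancelˡ-< c₂ j' c₃ j<)
                               (trans eq (glue-+ c₂ _ _ j'))

    e-disjoint : ∀ i j → i < ax → j < c₂ + c₃ → pe x i ≢ e₂₃ j
    e-disjoint i j i< j< eq with split-at c₂ j
    ... | inj₁ j<c₂ = pe-disjoint x p₂ i j x≢p₂ i< j<c₂ (trans eq (glue-< c₂ _ _ j j<c₂))
    ... | inj₂ (j' , refl) = pe-disjoint x p₃ i j' x≢p₃ i< (+-cancelˡ-< c₂ j' c₃ j<) (trans eq (glue-+ c₂ _ _ j'))

    covered : ∀ h → h ∈ pathUnion S → Σ ℕ λ i → i < ax + (c₂ + c₃) × e i ≡ h
    covered h h∈ with S⊆ (owner h) (∈pathUnion⇒ S h h∈)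
    ... | inj₁ o with owned⇒pe h x o
    ...   | j , j< , eq = j , ≤-trans j< (m≤m+n ax _) , trans (glue-< ax _ _ j j<) eq
    covered h h∈ | inj₂ (inj₁ o) with owned⇒pe h p₂ o
    ...   | j , j< , eq = ax + j , +-monoʳ-< ax (≤-trans j< (m≤m+n c₂ c₃)) ,
                          trans (glue-+ ax _ _ j) (trans (glue-< c₂ _ _ j j<) eq)
    covered h h∈ | inj₂ (inj₂ o) with owned⇒pe h p₃ o
    ...   | j , j< , eq = ax + (c₂ + j) , +-monoʳ-< ax (+-monoʳ-< c₂ j<) ,
                          trans (glue-+ ax _ _ (c₂ + j)) (trans (glue-+ c₂ _ _ j) eq)

    within : ∀ h → (Σ ℕ λ i → i < ax + (c₂ + c₃) × e i ≡ h) → h ∈ pathUnion S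
    within h (i , i< , eq) with split-at ax i
    ... | inj₁ i<ax = subst (_∈ pathUnion S) (trans (sym (glue-< ax _ _ i i<ax)) eq) (pe∈pathUnion S x i i<ax Sx)
    ... | inj₂ (j , refl) with split-at c₂ j
    ...   | inj₁ j<c₂ = subst (_∈ pathUnion S) (trans (sym (trans (glue-+ ax _ _ j) (glue-< c₂ _ _ j j<c₂))) eq)
                          (pe∈pathUnion S p₂ j j<c₂ S₂)
    ...   | inj₂ (j' , refl) = subst (_∈ pathUnion S) (trans (sym (trans (glue-+ ax _ _ (c₂ + j')) (glue-+ c₂ _ _ j'))) eq)
                                 (pe∈pathUnion S p₃ j' (+-cancelˡ-< c₂ j' c₃ (+-cancelˡ-< ax (c₂ + j') (c₂ + c₃) i<)) S₃)

    cycle : IsCycleSet G (pathUnion S)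
    cycle = closedPath⇒IsCycleSet (pathUnion S) (ax + (c₂ + c₃))
      (≤-trans (2≤m+n (0<len x) (0<len p₂)) (+-monoʳ-≤ ax (m≤m+n c₂ c₃))) v e
      (glue-injective ax (c₂ + c₃) _ _ (pv-injectiveBelow x)
        (glue-injective c₂ c₃ _ _ (pv-injectiveBelow p₂) (pv-injectiveBelow p₃)
          (λ i j i< j< → pv-disjoint p₂ p₃ i j (λ ()) (λ ()) i< j<))
        v-disjoint)
      (glue-injective ax (c₂ + c₃) _ _ (pe-injectiveBelow x)
        (glue-injective c₂ c₃ _ _ (pe-injectiveBelow p₂) (pe-injectiveBelow p₃)
          (λ i j i< j< → pe-disjoint p₂ p₃ i j (λ ()) i< j<))
        e-disjoint)
      (glue-joins ax (c₂ + c₃) (pv x) v₂₃ (pe x) e₂₃ (pe-joins x)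
        (trans (pv-len x) (trans (cong φ tx) (trans (sym (pv-0 p₂)) (sym (glue-< c₂ (pv p₂) (pv p₃) 0 (0<len p₂))))))
        (glue-joins c₂ c₃ (pv p₂) (pv p₃) (pe p₂) (pe p₃) (pe-joins p₂) (trans (pv-len p₂) (sym (pv-0 p₃))) (pe-joins p₃)))
      (trans (glue-+ ax (pv x) v₂₃ (c₂ + c₃)) (trans (glue-+ c₂ (pv p₂) (pv p₃) c₃)
        (trans (pv-len p₃) (trans (cong φ (sym sx)) (trans (sym (pv-0 x)) (sym (glue-< ax (pv x) v₂₃ 0 (0<len x))))))))
      covered within

  paths023-cycle : IsCycleSet G (pathUnion paths023)
  paths023-cycle = Through-p₂p₃.cycle p₀ paths023 refl refl (λ ()) (λ ()) refl refl refl
    λ { p₀ _ → inj₁ refl ; p₂ _ → inj₂ (inj₁ refl) ; p₃ _ → inj₂ (inj₂ refl) ; p₁ () }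

  paths123-cycle : IsCycleSet G (pathUnion paths123)
  paths123-cycle = Through-p₂p₃.cycle p₁ paths123 refl refl (λ ()) (λ ()) refl refl refl
    λ { p₁ _ → inj₁ refl ; p₂ _ → inj₂ (inj₁ refl) ; p₃ _ → inj₂ (inj₂ refl) ; p₀ () }

OneOf : ∀ {A : Set} → A → A → A → A → Set
OneOf x a b c = x ≡ a ⊎ x ≡ b ⊎ x ≡ c

oneOf-rotate : ∀ {A : Set} {x a b c : A} → OneOf x a b c ⇔ OneOf x c a b
oneOf-rotate = mk⇔ rotate rotate⁻¹
  where
  rotate : ∀ {A : Set} {x a b c : A} → OneOf x a b c → OneOf x c a b
  rotate (inj₁ x≡a)        = inj₂ (inj₁ x≡a)
  rotate (inj₂ (inj₁ x≡b)) = inj₂ (inj₂ x≡b)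
  rotate (inj₂ (inj₂ x≡c)) = inj₁ x≡c
  rotate⁻¹ : ∀ {A : Set} {x a b c : A} → OneOf x c a b → OneOf x a b c
  rotate⁻¹ (inj₁ x≡c)        = inj₂ (inj₂ x≡c)
  rotate⁻¹ (inj₂ (inj₁ x≡a)) = inj₁ x≡a
  rotate⁻¹ (inj₂ (inj₂ x≡b)) = inj₂ (inj₁ x≡b)

oneOf-swap : ∀ {A : Set} {x a b c : A} → OneOf x a b c ⇔ OneOf x b a c
oneOf-swap = mk⇔ swap swap
  where
  swap : ∀ {A : Set} {x a b c : A} → OneOf x a b c → OneOf x b a c
  swap (inj₁ x≡a)        = inj₂ (inj₁ x≡a)
  swap (inj₂ (inj₁ x≡b)) = inj₁ x≡b
  swap (inj₂ (inj₂ x≡c)) = inj₂ (inj₂ x≡c)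

lookup-ext : ∀ {A : Set} {n} {u v : Vec A n} → (∀ i → lookup u i ≡ lookup v i) → u ≡ v
lookup-ext {u = u} {v} u≗v = trans (sym (tabulate∘lookup u)) (trans (tabulate-cong u≗v) (tabulate∘lookup v))

does⇒witness : ∀ {A : Set} (a? : Dec A) → does a? ≡ true → A
does⇒witness (yes a) _ = a

element : ∀ {n} (p : Subset n) → Fin ∣ p ∣ → Fin n
element (true ∷ p)  zero    = zero
element (true ∷ p)  (suc k) = suc (element p k)
element (false ∷ p) k       = suc (element p k)

rank : ∀ {n} → Subset n → Fin n → ℕ
rank (_ ∷ p)     zero    = 0
rank (true ∷ p)  (suc x) = suc (rank p x)
rank (false ∷ p) (suc x) = rank p x

element∈ : ∀ {n} (p : Subset n) k → lookup p (element p k) ≡ true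
element∈ (true ∷ p)  zero    = refl
element∈ (true ∷ p)  (suc k) = element∈ p k
element∈ (false ∷ p) k       = element∈ p k

rank-element : ∀ {n} (p : Subset n) k → rank p (element p k) ≡ toℕ k
rank-element (true ∷ p)  zero    = refl
rank-element (true ∷ p)  (suc k) = cong suc (rank-element p k)
rank-element (false ∷ p) k       = rank-element p k

rank< : ∀ {n} (p : Subset n) x → lookup p x ≡ true → rank p x < ∣ p ∣
rank< (true ∷ p)  zero    _  = s≤s z≤n
rank< (true ∷ p)  (suc x) x∈ = s≤s (rank< p x x∈)
rank< (false ∷ p) (suc x) x∈ = rank< p x x∈

element-rank : ∀ {n} (p : Subset n) x (x∈ : lookup p x ≡ true) → element p (fromℕ< (rank< p x x∈)) ≡ x
element-rank (true ∷ p)  zero    _  = refl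
element-rank (true ∷ p)  (suc x) x∈ = cong suc (element-rank p x x∈)
element-rank (false ∷ p) (suc x) x∈ = cong suc (element-rank p x x∈)

element-injective : ∀ {n} (p : Subset n) → Injective _≡_ _≡_ (element p)
element-injective p {k} {k'} eq = toℕ-injective (trans (sym (rank-element p k)) (trans (cong (rank p) eq) (rank-element p k')))

rank-injective : ∀ {n} (p : Subset n) x y → lookup p x ≡ true → lookup p y ≡ true → rank p x ≡ rank p y → x ≡ y
rank-injective p x y x∈ y∈ eq = trans (sym (element-rank p x x∈))
  (trans (cong (element p) (toℕ-injective (trans (toℕ-fromℕ< _) (trans eq (sym (toℕ-fromℕ< _))))))
    (element-rank p y y∈))

∣p∣≡suc⇒nonempty : ∀ {n m} (p : Subset n) → ∣ p ∣ ≡ suc m → Σ (Fin n) λ x → lookup p x ≡ true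
∣p∣≡suc⇒nonempty p eq = element p (cast (sym eq) zero) , element∈ p _

∣p∣≡0⇒∉ : ∀ {n} (p : Subset n) x → ∣ p ∣ ≡ 0 → lookup p x ≡ true → ⊥
∣p∣≡0⇒∉ p x eq x∈ with subst (rank p x <_) eq (rank< p x x∈)
... | ()

-- both inequalities come from Fin-injections: through rank one way, through element the other
∣injective-image∣≡ : ∀ {m n} (p : Subset n) (g : Fin m → Fin n) → Injective _≡_ _≡_ g →
  (∀ i → lookup p (g i) ≡ true) → (∀ x → lookup p x ≡ true → Σ (Fin m) λ i → g i ≡ x) → ∣ p ∣ ≡ m
∣injective-image∣≡ {m} p g g-inj g∈ onto = ≤-antisym (injective⇒≤ element-pre-injective) (injective⇒≤ rank-g-injective)
  where
  rank-g : Fin m → Fin ∣ p ∣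
  rank-g i = fromℕ< (rank< p (g i) (g∈ i))
  rank-g-injective : Injective _≡_ _≡_ rank-g
  rank-g-injective {i} {j} eq = g-inj (rank-injective p (g i) (g j) (g∈ i) (g∈ j)
    (trans (sym (toℕ-fromℕ< _)) (trans (cong toℕ eq) (toℕ-fromℕ< _))))
  element-pre : Fin ∣ p ∣ → Fin m
  element-pre k = proj₁ (onto (element p k) (element∈ p k))
  element-pre-injective : Injective _≡_ _≡_ element-pre
  element-pre-injective {k} {k'} eq = element-injective p (trans (sym (proj₂ (onto (element p k) (element∈ p k))))
    (trans (cong g eq) (proj₂ (onto (element p k') (element∈ p k')))))

∣p∣≡∣p∩q∣+∣p─q∣ : ∀ {n} (p q : Subset n) → ∣ p ∣ ≡ ∣ p ∩ q ∣ + ∣ p ─ q ∣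
∣p∣≡∣p∩q∣+∣p─q∣ []          []          = refl
∣p∣≡∣p∩q∣+∣p─q∣ (true ∷ p)  (true ∷ q)  = cong suc (∣p∣≡∣p∩q∣+∣p─q∣ p q)
∣p∣≡∣p∩q∣+∣p─q∣ (true ∷ p)  (false ∷ q) = trans (cong suc (∣p∣≡∣p∩q∣+∣p─q∣ p q)) (sym (+-suc _ _))
∣p∣≡∣p∩q∣+∣p─q∣ (false ∷ p) (true ∷ q)  = ∣p∣≡∣p∩q∣+∣p─q∣ p q
∣p∣≡∣p∩q∣+∣p─q∣ (false ∷ p) (false ∷ q) = ∣p∣≡∣p∩q∣+∣p─q∣ p q

lookup-─ : ∀ {n} (p q : Subset n) x → lookup (p ─ q) x ≡ lookup p x ∧ not (lookup q x)
lookup-─ (b ∷ p) (true ∷ q)  zero    = sym (∧-zeroʳ b)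
lookup-─ (b ∷ p) (false ∷ q) zero    = sym (∧-identityʳ b)
lookup-─ (b ∷ p) (c ∷ q)     (suc x) = lookup-─ p q x

parity : ℕ → Bool
parity zero    = false
parity (suc n) = not (parity n)

Odd⇒parity : ∀ n → Odd n → parity n ≡ true
parity⇒Odd : ∀ n → parity n ≡ true → Odd n
parity⇒Even : ∀ n → parity n ≡ false → n % 2 ≡ 0
Odd⇒parity zero          ()
Odd⇒parity (suc zero)    _ = refl
Odd⇒parity (suc (suc n)) o with parity n in p
... | true  = refl
... | false with trans (sym (parity⇒Even n p)) o
...   | ()
parity⇒Odd zero          ()
parity⇒Odd (suc zero)    _ = refl
parity⇒Odd (suc (suc n)) _ with parity n in p
parity⇒Odd (suc (suc n)) refl | true = parity⇒Odd n p
parity⇒Even zero          _ = refl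
parity⇒Even (suc zero)    ()
parity⇒Even (suc (suc n)) _ with parity n in p
parity⇒Even (suc (suc n)) refl | false = parity⇒Even n p

parity-+ : ∀ m n → parity (m + n) ≡ parity m xor parity n
parity-+ zero    n = refl
parity-+ (suc m) n rewrite parity-+ m n with parity m | parity n
... | true  | true  = refl
... | true  | false = refl
... | false | true  = refl
... | false | false = refl

ThreeCircuits : ∀ {n} → Matroid n → Set
ThreeCircuits M = ∃[ C₁ ] ∃[ C₂ ] ( Circuit M C₁ × Circuit M C₂ × (C₁ ∪ C₂ ≡ ⊤) × Odd ∣ C₁ ∣ × Odd ∣ C₂ ─ C₁ ∣
                                  × (∀ C → Circuit M C ⇔ OneOf C C₁ C₂ (C₁ Δ C₂)))

onlyPath : Fin 4 → Fin 4 → Bool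
onlyPath f g = does (f ≟ g)

deselect : Fin 4 → (Fin 4 → Bool) → Fin 4 → Bool
deselect f S g = S g ∧ not (onlyPath f g)

module OddC3⁺⇒ThreeCircuits {n : ℕ} (M : Matroid n) (G : Graph) (T : TotallyOddSubdivision G C3⁺)
    (σ : Fin n ⤖ Fin (nE G))
    (iso : ∀ (D : Subset (nE G)) → IsCycleSet G D ⇔ Circuit M (tabulate λ i → lookup D (Bijection.to σ i))) where

  open TotallyOddSubdivision T
  open GraphFacts G using (module PathIndexing)
  open Subdivision G T
  open PathUnion G T
  open SubdivisionCycles G T
  open Bijection σ using (to; injective; surjective)

  private
    from : Fin (nE G) → Fin n
    from y = proj₁ (surjective y)

    to-from : ∀ y → to (from y) ≡ y
    to-from y = proj₂ (surjective y) refl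

    from-to : ∀ x → from (to x) ≡ x
    from-to x = injective (to-from (to x))

    pull : Subset (nE G) → Subset n
    pull D = tabulate λ i → lookup D (to i)

    push : Subset n → Subset (nE G)
    push C = tabulate λ y → lookup C (from y)

    pull-push : ∀ C → pull (push C) ≡ C
    pull-push C = lookup-ext λ i → trans (lookup∘tabulate _ i) (trans (lookup∘tabulate _ (to i)) (cong (lookup C) (from-to i)))

    paths : (Fin 4 → Bool) → Subset n
    paths S = pull (pathUnion S)

    lookup-paths : ∀ S i → lookup (paths S) i ≡ S (owner (to i))
    lookup-paths S i = trans (lookup∘tabulate _ i) (lookup∘tabulate _ (to i))

    paths-cong : ∀ S S' → (∀ f → S f ≡ S' f) → paths S ≡ paths S'
    paths-cong S S' S≗S' = lookup-ext λ i → trans (lookup-paths S i) (trans (S≗S' _) (sym (lookup-paths S' i)))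

    zipWith-paths : ∀ (op : Bool → Bool → Bool) S S' → zipWith op (paths S) (paths S') ≡ paths (λ f → op (S f) (S' f))
    zipWith-paths op S S' = lookup-ext λ i → trans (lookup-zipWith op i (paths S) (paths S'))
      (trans (cong₂ op (lookup-paths S i) (lookup-paths S' i)) (sym (lookup-paths (λ f → op (S f) (S' f)) i)))

    paths-─ : ∀ S S' → paths S ─ paths S' ≡ paths (λ f → S f ∧ not (S' f))
    paths-─ S S' = lookup-ext λ i → trans (lookup-─ (paths S) (paths S') i)
      (trans (cong₂ (λ x y → x ∧ not y) (lookup-paths S i) (lookup-paths S' i)) (sym (lookup-paths (λ f → S f ∧ not (S' f)) i)))

    ∣onlyPath∣ : ∀ f → ∣ paths (onlyPath f) ∣ ≡ len f
    ∣onlyPath∣ f = ∣injective-image∣≡ (paths (onlyPath f)) g g-injective g∈ onto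
      where
      g : Fin (len f) → Fin n
      g i = from (edge (path f) i)
      g-injective : Injective _≡_ _≡_ g
      g-injective eq = edge-inj (path f) (trans (sym (to-from _)) (trans (cong to eq) (to-from _)))
      owner-edge : ∀ i → owner (edge (path f) i) ≡ f
      owner-edge i = subst (λ z → owner z ≡ f) (PathIndexing.pe-toℕ (path f) _ i) (owner-pe f (toℕ i) (toℕ<n i))
      g∈ : ∀ i → lookup (paths (onlyPath f)) (g i) ≡ true
      g∈ i = trans (lookup-paths (onlyPath f) (g i))
        (trans (cong (λ z → onlyPath f (owner z)) (to-from _)) (trans (cong (onlyPath f) (owner-edge i)) (dec-true (f ≟ f) refl)))
      onto : ∀ x → lookup (paths (onlyPath f)) x ≡ true → Σ (Fin (len f)) λ i → g i ≡ x
      onto x x∈ with owned⇒pe (to x) f (sym (does⇒witness (f ≟ _) (trans (sym (lookup-paths (onlyPath f) x)) x∈)))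
      ... | j , j< , pe≡ with nth-< (edge (path f)) _ j j<
      ...   | t , _ , pe≡t = t , trans (cong from (trans (sym pe≡t) pe≡)) (from-to x)

    ∣paths∣-deselect : ∀ S f → S f ≡ true → ∣ paths S ∣ ≡ len f + ∣ paths (deselect f S) ∣
    ∣paths∣-deselect S f Sf = trans (∣p∣≡∣p∩q∣+∣p─q∣ (paths S) (paths (onlyPath f)))
      (cong₂ _+_ (trans (cong ∣_∣ (trans (zipWith-paths _∧_ S (onlyPath f)) (paths-cong (λ g → S g ∧ onlyPath f g) (onlyPath f) meet))) (∣onlyPath∣ f))
                 (cong ∣_∣ (paths-─ S (onlyPath f))))
      where
      meet : ∀ g → S g ∧ onlyPath f g ≡ onlyPath f g
      meet g with f ≟ g
      ... | yes refl = trans (∧-identityʳ (S f)) Sf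
      ... | no  _    = ∧-zeroʳ (S g)

  C₁ C₂ : Subset n
  C₁ = paths paths023
  C₂ = paths paths123

  ∣C₁∣ : ∣ C₁ ∣ ≡ len p₀ + (len p₂ + len p₃)
  ∣C₁∣ = begin
    ∣ paths paths023 ∣                                       ≡⟨ ∣paths∣-deselect paths023 p₀ refl ⟩
    len p₀ + ∣ paths (deselect p₀ paths023) ∣                ≡⟨ cong (len p₀ +_) (∣paths∣-deselect (deselect p₀ paths023) p₂ refl) ⟩
    len p₀ + (len p₂ + ∣ paths (deselect p₂ (deselect p₀ paths023)) ∣)
      ≡⟨ cong (λ k → len p₀ + (len p₂ + k)) (trans (cong ∣_∣ (paths-cong (deselect p₂ (deselect p₀ paths023)) (onlyPath p₃) only-p₃)) (∣onlyPath∣ p₃)) ⟩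
    len p₀ + (len p₂ + len p₃)                               ∎
    where
    open ≡-Reasoning
    only-p₃ : ∀ f → deselect p₂ (deselect p₀ paths023) f ≡ onlyPath p₃ f
    only-p₃ p₀ = refl
    only-p₃ p₁ = refl
    only-p₃ p₂ = refl
    only-p₃ p₃ = refl

  Odd∣C₁∣ : Odd ∣ C₁ ∣
  Odd∣C₁∣ = parity⇒Odd ∣ C₁ ∣ (begin
    parity ∣ C₁ ∣                                          ≡⟨ cong parity ∣C₁∣ ⟩
    parity (len p₀ + (len p₂ + len p₃))                    ≡⟨ parity-+ (len p₀) _ ⟩
    parity (len p₀) xor parity (len p₂ + len p₃)           ≡⟨ cong (parity (len p₀) xor_) (parity-+ (len p₂) (len p₃)) ⟩
    parity (len p₀) xor (parity (len p₂) xor parity (len p₃))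
      ≡⟨ cong₂ _xor_ (odd p₀) (cong₂ _xor_ (odd p₂) (odd p₃)) ⟩
    true                                                   ∎)
    where
    open ≡-Reasoning
    odd : ∀ f → parity (len f) ≡ true
    odd f = Odd⇒parity (len f) (len-odd f)

  Odd∣C₂─C₁∣ : Odd ∣ C₂ ─ C₁ ∣
  Odd∣C₂─C₁∣ = subst Odd (sym (trans (cong ∣_∣ C₂─C₁≡p₁) (∣onlyPath∣ p₁))) (len-odd p₁)
    where
    C₂─C₁≡p₁ : C₂ ─ C₁ ≡ paths (onlyPath p₁)
    C₂─C₁≡p₁ = trans (paths-─ paths123 paths023) (paths-cong (λ f → paths123 f ∧ not (paths023 f)) (onlyPath p₁) λ { p₀ → refl ; p₁ → refl ; p₂ → refl ; p₃ → refl })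

  C₁∪C₂≡⊤ : C₁ ∪ C₂ ≡ ⊤
  C₁∪C₂≡⊤ = trans (zipWith-paths _∨_ paths023 paths123)
    (lookup-ext λ i → trans (lookup-paths (λ f → paths023 f ∨ paths123 f) i) (trans (covers (owner (to i))) (sym (lookup-replicate i true))))
    where
    covers : ∀ f → paths023 f ∨ paths123 f ≡ true
    covers p₀ = refl
    covers p₁ = refl
    covers p₂ = refl
    covers p₃ = refl

  C₁ΔC₂≡paths01 : C₁ Δ C₂ ≡ paths paths01
  C₁ΔC₂≡paths01 = trans (zipWith-paths _xor_ paths023 paths123) (paths-cong (λ f → paths023 f xor paths123 f) paths01 λ { p₀ → refl ; p₁ → refl ; p₂ → refl ; p₃ → refl })

  Circuit-C₁ : Circuit M C₁
  Circuit-C₁ = Equivalence.to (iso _) paths023-cycle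

  Circuit-C₂ : Circuit M C₂
  Circuit-C₂ = Equivalence.to (iso _) paths123-cycle

  circuit⇔ : ∀ C → Circuit M C ⇔ OneOf C C₁ C₂ (C₁ Δ C₂)
  circuit⇔ C = mk⇔ classify circuit
    where
    classify : Circuit M C → OneOf C C₁ C₂ (C₁ Δ C₂)
    classify C-circ with CycleClassification.cycle-classification G T (push C)
                          (Equivalence.from (iso (push C)) (subst (Circuit M) (sym (pull-push C)) C-circ))
    ... | inj₁ e        = inj₂ (inj₂ (trans (sym (pull-push C)) (trans (cong pull e) (sym C₁ΔC₂≡paths01))))
    ... | inj₂ (inj₁ e) = inj₁ (trans (sym (pull-push C)) (cong pull e))
    ... | inj₂ (inj₂ e) = inj₂ (inj₁ (trans (sym (pull-push C)) (cong pull e)))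
    circuit : OneOf C C₁ C₂ (C₁ Δ C₂) → Circuit M C
    circuit (inj₁ refl)        = Circuit-C₁
    circuit (inj₂ (inj₁ refl)) = Circuit-C₂
    circuit (inj₂ (inj₂ refl)) = subst (Circuit M) (sym C₁ΔC₂≡paths01) (Equivalence.to (iso _) paths01-cycle)

-- Vertex labels along a path with m inner vertices from branch vertex s to branch vertex t:
-- the inner vertices are labelled off + 1, …, off + m.
pathLabel : ℕ → ℕ → ℕ → ℕ → ℕ → ℕ
pathLabel s t off m zero    = s
pathLabel s t off m (suc j) with j <? m
... | yes _ = off + suc j
... | no  _ = t

pathLabel-inner : ∀ s t off m i → 0 < i → i < suc m → pathLabel s t off m i ≡ off + i
pathLabel-inner s t off m (suc j) _ (s≤s j<m) with j <? m
... | yes _  = refl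
... | no j≮m = ⊥-elim (j≮m j<m)

pathLabel-end : ∀ s t off m → pathLabel s t off m (suc m) ≡ t
pathLabel-end s t off m with m <? m
... | yes m<m = ⊥-elim (<-irrefl refl m<m)
... | no  _   = refl

pathLabel-view : ∀ s t off m i → i ≤ suc m →
  (i ≡ 0 × pathLabel s t off m i ≡ s) ⊎ (i ≡ suc m × pathLabel s t off m i ≡ t) ⊎
  (0 < i × i < suc m × pathLabel s t off m i ≡ off + i)
pathLabel-view s t off m i i≤ with boundary-or-inner i (suc m) i≤
... | inj₁ refl              = inj₁ (refl , refl)
... | inj₂ (inj₁ refl)       = inj₂ (inj₁ (refl , pathLabel-end s t off m))
... | inj₂ (inj₂ (0<i , i<)) = inj₂ (inj₂ (0<i , i< , pathLabel-inner s t off m i 0<i i<))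

3≤off+i : ∀ off i → 2 ≤ off → 0 < i → 3 ≤ off + i
3≤off+i off (suc i) 2≤off _ = subst (3 ≤_) (sym (+-suc off i)) (s≤s (≤-trans 2≤off (m≤m+n off i)))

pathLabel-injective : ∀ s t off m → s ≢ t → s < 3 → t < 3 → 2 ≤ off →
  ∀ i j → i ≤ suc m → j ≤ suc m → pathLabel s t off m i ≡ pathLabel s t off m j → i ≡ j
pathLabel-injective s t off m s≢t s<3 t<3 2≤off i j i≤ j≤ eq
  with pathLabel-view s t off m i i≤ | pathLabel-view s t off m j j≤
... | inj₁ (refl , _)       | inj₁ (refl , _)       = refl
... | inj₂ (inj₁ (refl , _)) | inj₂ (inj₁ (refl , _)) = refl
... | inj₁ (_ , p)          | inj₂ (inj₁ (_ , q))   = ⊥-elim (s≢t (trans (sym p) (trans eq q)))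
... | inj₂ (inj₁ (_ , p))   | inj₁ (_ , q)          = ⊥-elim (s≢t (trans (sym q) (trans (sym eq) p)))
... | inj₁ (_ , p) | inj₂ (inj₂ (0<j , _ , q)) =
  ⊥-elim (<⇒≱ s<3 (subst (3 ≤_) (trans (sym q) (trans (sym eq) p)) (3≤off+i off j 2≤off 0<j)))
... | inj₂ (inj₁ (_ , p)) | inj₂ (inj₂ (0<j , _ , q)) =
  ⊥-elim (<⇒≱ t<3 (subst (3 ≤_) (trans (sym q) (trans (sym eq) p)) (3≤off+i off j 2≤off 0<j)))
... | inj₂ (inj₂ (0<i , _ , p)) | inj₁ (_ , q) =
  ⊥-elim (<⇒≱ s<3 (subst (3 ≤_) (trans (sym p) (trans eq q)) (3≤off+i off i 2≤off 0<i)))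
... | inj₂ (inj₂ (0<i , _ , p)) | inj₂ (inj₁ (_ , q)) =
  ⊥-elim (<⇒≱ t<3 (subst (3 ≤_) (trans (sym p) (trans eq q)) (3≤off+i off i 2≤off 0<i)))
... | inj₂ (inj₂ (_ , _ , p)) | inj₂ (inj₂ (_ , _ , q)) = +-cancelˡ-≡ off i j (trans (sym p) (trans eq q))

pathLabel≤ : ∀ s t off m N → s ≤ N → t ≤ N → off + m ≤ N → ∀ i → i ≤ suc m → pathLabel s t off m i ≤ N
pathLabel≤ s t off m N s≤N t≤N off+m≤N i i≤ with pathLabel-view s t off m i i≤
... | inj₁ (_ , p)               = subst (_≤ N) (sym p) s≤N
... | inj₂ (inj₁ (_ , p))        = subst (_≤ N) (sym p) t≤N
... | inj₂ (inj₂ (_ , i< , p))   = subst (_≤ N) (sym p) (≤-trans (+-monoʳ-≤ off (≤-pred i<)) off+m≤N)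

-- x as an element of Fin (suc N); a junk value when x > N
clamp : ∀ N → ℕ → Fin (suc N)
clamp N       zero    = zero
clamp zero    (suc x) = zero
clamp (suc N) (suc x) = suc (clamp N x)

toℕ-clamp : ∀ N x → x ≤ N → toℕ (clamp N x) ≡ x
toℕ-clamp N       zero    _         = refl
toℕ-clamp (suc N) (suc x) (s≤s x≤N) = cong suc (toℕ-clamp N x x≤N)

clamp-toℕ : ∀ N (v : Fin (suc N)) → clamp N (toℕ v) ≡ v
clamp-toℕ N       zero    = refl
clamp-toℕ (suc N) (suc v) = cong suc (clamp-toℕ N v)

clamp-injective : ∀ N x y → x ≤ N → y ≤ N → clamp N x ≡ clamp N y → x ≡ y
clamp-injective N x y x≤N y≤N eq = trans (sym (toℕ-clamp N x x≤N)) (trans (cong toℕ eq) (toℕ-clamp N y y≤N))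

label-ranges-disjoint : ∀ x y i j m → x + i ≡ y + j → i ≤ m → x + m ≤ y → 0 < j → ⊥
label-ranges-disjoint x y i j m eq i≤m x+m≤y (s≤s z≤n) =
  <-irrefl eq (≤-<-trans (≤-trans (+-monoʳ-≤ x i≤m) x+m≤y) (subst (y <_) (sym (+-suc y _)) (s≤s (m≤m+n y _))))

pattern k₀ = zero
pattern k₁ = suc zero
pattern k₂ = suc (suc zero)

colourOf : Fin 4 → Fin 3
colourOf p₀ = k₀
colourOf p₁ = k₁
colourOf p₂ = k₂
colourOf p₃ = k₂

colourClass : ∀ {n} → (Fin n → Fin 3) → Fin 3 → Subset n
colourClass col k = tabulate λ x → does (col x ≟ k)

colourUnion : ∀ {n} → (Fin n → Fin 3) → (Fin 3 → Bool) → Subset n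
colourUnion col cs = tabulate λ x → cs (col x)

colours01 colours02 colours12 : Fin 3 → Bool
colours01 k₂ = false
colours01 _  = true
colours02 k₁ = false
colours02 _  = true
colours12 k₀ = false
colours12 _  = true

-- The odd-C₃⁺ graph realising a colouring of the ground set: colour k₀ becomes p₀, colour k₁ becomes p₁,
-- and colour k₂ becomes p₂ (its first member) followed by p₃ (the others), each class traversed in
-- increasing order.  Vertex labels: branch vertices 0, 1, 2, then the inner vertices of p₀, p₁ and p₃.
module Construction (n : ℕ) (col : Fin n → Fin 3) (a b c : ℕ)
    (∣K₀∣ : ∣ colourClass col k₀ ∣ ≡ suc a) (∣K₁∣ : ∣ colourClass col k₁ ∣ ≡ suc b)
    (∣K₂∣ : ∣ colourClass col k₂ ∣ ≡ suc (suc c))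
    (odd-a : Odd (suc a)) (odd-b : Odd (suc b)) (odd-c : Odd (suc c)) where

  off₁ off₃ N : ℕ
  off₁ = 2 + a
  off₃ = off₁ + b
  N    = off₃ + c

  private
    off₁+b≤N : off₁ + b ≤ N
    off₁+b≤N = m≤m+n off₃ c
    off₁≤N : off₁ ≤ N
    off₁≤N = ≤-trans (m≤m+n off₁ b) off₁+b≤N
    2≤N : 2 ≤ N
    2≤N = ≤-trans (m≤m+n 2 a) off₁≤N
    1≤N : 1 ≤ N
    1≤N = ≤-trans (s≤s z≤n) 2≤N
    2≤off₁ : 2 ≤ off₁
    2≤off₁ = m≤m+n 2 a
    2≤off₃ : 2 ≤ off₃
    2≤off₃ = ≤-trans 2≤off₁ (m≤m+n off₁ b)

  label₀ label₁ label₃ label₂₃ : ℕ → ℕ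
  label₀ = pathLabel 0 1 2 a
  label₁ = pathLabel 0 1 off₁ b
  label₃ = pathLabel 2 0 off₃ c
  label₂₃ zero    = 1
  label₂₃ (suc i) = label₃ i

  classLength : Fin 3 → ℕ
  classLength k₀ = suc a
  classLength k₁ = suc b
  classLength k₂ = suc (suc c)

  classLabel : Fin 3 → ℕ → ℕ
  classLabel k₀ = label₀
  classLabel k₁ = label₁
  classLabel k₂ = label₂₃

  private
    label₃≢1 : ∀ i → i ≤ suc c → label₃ i ≢ 1
    label₃≢1 i i≤ eq with pathLabel-view 2 0 off₃ c i i≤
    ... | inj₁ (_ , p) with trans (sym p) eq
    ...   | ()
    label₃≢1 i i≤ eq | inj₂ (inj₁ (_ , p)) with trans (sym p) eq
    ...   | ()
    label₃≢1 i i≤ eq | inj₂ (inj₂ (0<i , _ , p)) =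
      <⇒≱ (s≤s (s≤s z≤n)) (subst (3 ≤_) (trans (sym p) eq) (3≤off+i off₃ i 2≤off₃ 0<i))

    label₂₃-injective : ∀ i j → i ≤ suc (suc c) → j ≤ suc (suc c) → label₂₃ i ≡ label₂₃ j → i ≡ j
    label₂₃-injective zero    zero    _         _         _  = refl
    label₂₃-injective zero    (suc j) _         (s≤s j≤)  eq = ⊥-elim (label₃≢1 j j≤ (sym eq))
    label₂₃-injective (suc i) zero    (s≤s i≤)  _         eq = ⊥-elim (label₃≢1 i i≤ eq)
    label₂₃-injective (suc i) (suc j) (s≤s i≤)  (s≤s j≤)  eq =
      cong suc (pathLabel-injective 2 0 off₃ c (λ ()) (s≤s ≤-refl) (s≤s z≤n) 2≤off₃ i j i≤ j≤ eq)

  classLabel-injective : ∀ k i j → i ≤ classLength k → j ≤ classLength k → classLabel k i ≡ classLabel k j → i ≡ j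
  classLabel-injective k₀ = pathLabel-injective 0 1 2 a (λ ()) (s≤s z≤n) (s≤s (s≤s z≤n)) ≤-refl
  classLabel-injective k₁ = pathLabel-injective 0 1 off₁ b (λ ()) (s≤s z≤n) (s≤s (s≤s z≤n)) 2≤off₁
  classLabel-injective k₂ = label₂₃-injective

  classLabel≤N : ∀ k i → i ≤ classLength k → classLabel k i ≤ N
  classLabel≤N k₀ = pathLabel≤ 0 1 2 a N z≤n 1≤N off₁≤N
  classLabel≤N k₁ = pathLabel≤ 0 1 off₁ b N z≤n 1≤N off₁+b≤N
  classLabel≤N k₂ zero    _        = 1≤N
  classLabel≤N k₂ (suc i) (s≤s i≤) = pathLabel≤ 2 0 off₃ c N 2≤N z≤n ≤-refl i i≤

  K : Fin 3 → Subset n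
  K = colourClass col

  ∣K∣ : ∀ k → ∣ K k ∣ ≡ classLength k
  ∣K∣ k₀ = ∣K₀∣
  ∣K∣ k₁ = ∣K₁∣
  ∣K∣ k₂ = ∣K₂∣

  member : ∀ k → Fin (classLength k) → Fin n
  member k t = element (K k) (cast (sym (∣K∣ k)) t)

  ∈K : ∀ k x → col x ≡ k → lookup (K k) x ≡ true
  ∈K k x refl = trans (lookup∘tabulate _ x) (dec-true (col x ≟ col x) refl)

  colour-member : ∀ k t → col (member k t) ≡ k
  colour-member k t = does⇒witness (col (member k t) ≟ k) (trans (sym (lookup∘tabulate _ (member k t))) (element∈ (K k) _))

  rank-member : ∀ k t → rank (K k) (member k t) ≡ toℕ t
  rank-member k t = trans (rank-element (K k) _) (toℕ-cast _ t)

  member-injective : ∀ k → Injective _≡_ _≡_ (member k)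
  member-injective k {t} {u} eq = toℕ-injective (trans (sym (rank-member k t)) (trans (cong (rank (K k)) eq) (rank-member k u)))

  rank<classLength : ∀ k x → col x ≡ k → rank (K k) x < classLength k
  rank<classLength k x colx = subst (rank (K k) x <_) (∣K∣ k) (rank< (K k) x (∈K k x colx))

  member-rank : ∀ k x (colx : col x ≡ k) → member k (fromℕ< (rank<classLength k x colx)) ≡ x
  member-rank k x colx = trans (cong (element (K k)) (toℕ-injective (trans (toℕ-cast _ _)
                           (trans (toℕ-fromℕ< _) (sym (toℕ-fromℕ< (rank< (K k) x (∈K k x colx))))))))
                         (element-rank (K k) x (∈K k x colx))

  endsOf : Fin n → Fin (suc N) × Fin (suc N)
  endsOf x = clamp N (classLabel (col x) (rank (K (col x)) x)) , clamp N (classLabel (col x) (suc (rank (K (col x)) x)))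

  endsOf-no-loop : ∀ x → proj₁ (endsOf x) ≢ proj₂ (endsOf x)
  endsOf-no-loop x eq = 1+n≢n (sym (classLabel-injective (col x) _ _ (<⇒≤ r<) r<
                          (clamp-injective N _ _ (classLabel≤N (col x) _ (<⇒≤ r<)) (classLabel≤N (col x) _ r<) eq)))
    where r< = rank<classLength (col x) x refl

  G : Graph
  G = record { nV = suc N ; nE = n ; ends = endsOf ; no-loop = endsOf-no-loop }

  endsOf-member : ∀ k t → endsOf (member k t) ≡ (clamp N (classLabel k (toℕ t)) , clamp N (classLabel k (suc (toℕ t))))
  endsOf-member k t = trans (cong (λ k' → clamp N (classLabel k' (rank (K k') (member k t))) ,
                                          clamp N (classLabel k' (suc (rank (K k') (member k t)))))
                                  (colour-member k t))
                            (cong (λ r → clamp N (classLabel k r) , clamp N (classLabel k (suc r))) (rank-member k t))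

  labelledPath : (L : ℕ) (w : ℕ → ℕ) (ed : Fin L → Fin n) →
    (∀ i j → i ≤ L → j ≤ L → w i ≡ w j → i ≡ j) → (∀ i → i ≤ L → w i ≤ N) → Injective _≡_ _≡_ ed →
    (∀ t → endsOf (ed t) ≡ (clamp N (w (toℕ t)) , clamp N (w (suc (toℕ t))))) → Path G L
  labelledPath L w ed w-inj w≤N ed-inj ed-ends = record
    { vert      = λ t → clamp N (w (toℕ t))
    ; edge      = ed
    ; vert-inj  = λ {x} {y} eq → toℕ-injective (w-inj _ _ (≤-pred (toℕ<n x)) (≤-pred (toℕ<n y))
                    (clamp-injective N _ _ (w≤N _ (≤-pred (toℕ<n x))) (w≤N _ (≤-pred (toℕ<n y))) eq))
    ; edge-inj  = ed-inj
    ; edge-join = λ t → inj₁ (trans (ed-ends t) (cong (λ i → clamp N (w i) , clamp N (w (suc (toℕ t)))) (sym (toℕ-inject₁ t))))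
    }

  pathLength : Fin 4 → ℕ
  pathLength p₀ = suc a
  pathLength p₁ = suc b
  pathLength p₂ = 1
  pathLength p₃ = suc c

  -- path f runs through its colour class from position shift f on
  shift : Fin 4 → ℕ
  shift p₃ = 1
  shift _  = 0

  shift+pathLength≤ : ∀ f → shift f + pathLength f ≤ classLength (colourOf f)
  shift+pathLength≤ p₀ = ≤-refl
  shift+pathLength≤ p₁ = ≤-refl
  shift+pathLength≤ p₂ = s≤s z≤n
  shift+pathLength≤ p₃ = ≤-refl

  pathLabelOf : Fin 4 → ℕ → ℕ
  pathLabelOf f i = classLabel (colourOf f) (shift f + i)

  pathEdge : (f : Fin 4) → Fin (pathLength f) → Fin n
  pathEdge p₀ = member k₀
  pathEdge p₁ = member k₁
  pathEdge p₂ _ = member k₂ zero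
  pathEdge p₃ t = member k₂ (suc t)

  private
    shift+≤ : ∀ f i → i ≤ pathLength f → shift f + i ≤ classLength (colourOf f)
    shift+≤ f i i≤ = ≤-trans (+-monoʳ-≤ (shift f) i≤) (shift+pathLength≤ f)

  pathLabelOf-injective : ∀ f i j → i ≤ pathLength f → j ≤ pathLength f → pathLabelOf f i ≡ pathLabelOf f j → i ≡ j
  pathLabelOf-injective f i j i≤ j≤ eq =
    +-cancelˡ-≡ (shift f) i j (classLabel-injective (colourOf f) _ _ (shift+≤ f i i≤) (shift+≤ f j j≤) eq)

  pathLabelOf≤N : ∀ f i → i ≤ pathLength f → pathLabelOf f i ≤ N
  pathLabelOf≤N f i i≤ = classLabel≤N (colourOf f) _ (shift+≤ f i i≤)

  pathEdge-injective : ∀ f → Injective _≡_ _≡_ (pathEdge f)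
  pathEdge-injective p₀ = member-injective k₀
  pathEdge-injective p₁ = member-injective k₁
  pathEdge-injective p₂ {zero} {zero} _ = refl
  pathEdge-injective p₃ eq = Data.Fin.Properties.suc-injective (member-injective k₂ eq)

  pathEdge-ends : ∀ f t → endsOf (pathEdge f t) ≡ (clamp N (pathLabelOf f (toℕ t)) , clamp N (pathLabelOf f (suc (toℕ t))))
  pathEdge-ends p₀ t    = endsOf-member k₀ t
  pathEdge-ends p₁ t    = endsOf-member k₁ t
  pathEdge-ends p₂ zero = endsOf-member k₂ zero
  pathEdge-ends p₃ t    = endsOf-member k₂ (suc t)

  path : (f : Fin 4) → Path G (pathLength f)
  path f = labelledPath (pathLength f) (pathLabelOf f) (pathEdge f)
             (pathLabelOf-injective f) (pathLabelOf≤N f) (pathEdge-injective f) (pathEdge-ends f)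

  colour-pathEdge : ∀ f t → col (pathEdge f t) ≡ colourOf f
  colour-pathEdge p₀ t = colour-member k₀ t
  colour-pathEdge p₁ t = colour-member k₁ t
  colour-pathEdge p₂ t = colour-member k₂ zero
  colour-pathEdge p₃ t = colour-member k₂ (suc t)

  rank-pathEdge : ∀ f t → rank (K (col (pathEdge f t))) (pathEdge f t) ≡ shift f + toℕ t
  rank-pathEdge f t = trans (cong (λ k → rank (K k) (pathEdge f t)) (colour-pathEdge f t)) (rank-pathEdge′ f t)
    where
    rank-pathEdge′ : ∀ f t → rank (K (colourOf f)) (pathEdge f t) ≡ shift f + toℕ t
    rank-pathEdge′ p₀ t    = rank-member k₀ t
    rank-pathEdge′ p₁ t    = rank-member k₁ t
    rank-pathEdge′ p₂ zero = rank-member k₂ zero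
    rank-pathEdge′ p₃ t    = rank-member k₂ (suc t)

  private
    position-unique : ∀ f g (i : Fin (pathLength f)) (j : Fin (pathLength g)) →
      colourOf f ≡ colourOf g → shift f + toℕ i ≡ shift g + toℕ j → f ≡ g × toℕ i ≡ toℕ j
    position-unique p₀ p₀ i j _ eq = refl , eq
    position-unique p₁ p₁ i j _ eq = refl , eq
    position-unique p₂ p₂ zero zero _ _ = refl , refl
    position-unique p₃ p₃ i j _ eq = refl , suc-injective eq
    position-unique p₂ p₃ zero j _ ()
    position-unique p₃ p₂ i zero _ ()
    position-unique p₀ p₁ _ _ () _
    position-unique p₀ p₂ _ _ () _
    position-unique p₀ p₃ _ _ () _
    position-unique p₁ p₀ _ _ () _
    position-unique p₁ p₂ _ _ () _
    position-unique p₁ p₃ _ _ () _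
    position-unique p₂ p₀ _ _ () _
    position-unique p₂ p₁ _ _ () _
    position-unique p₃ p₀ _ _ () _
    position-unique p₃ p₁ _ _ () _

  pathEdge-unique : ∀ f g i j → pathEdge f i ≡ pathEdge g j → f ≡ g × toℕ i ≡ toℕ j
  pathEdge-unique f g i j eq = position-unique f g i j
    (trans (sym (colour-pathEdge f i)) (trans (cong col eq) (colour-pathEdge g j)))
    (trans (sym (rank-pathEdge f i)) (trans (cong (λ x → rank (K (col x)) x) eq) (rank-pathEdge g j)))

  pathEdge-cover : ∀ x → ∃[ f ] ∃[ i ] pathEdge f i ≡ x
  pathEdge-cover x with col x in colx
  ... | k₀ = p₀ , fromℕ< (rank<classLength k₀ x colx) , member-rank k₀ x colx
  ... | k₁ = p₁ , fromℕ< (rank<classLength k₁ x colx) , member-rank k₁ x colx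
  ... | k₂ with rank (K k₂) x | rank<classLength k₂ x colx | member-rank k₂ x colx
  ...   | zero   | r< | mr = p₂ , zero , trans (cong (member k₂) (sym (toℕ-injective (toℕ-fromℕ< r<)))) mr
  ...   | suc r' | r< | mr = p₃ , fromℕ< (≤-pred r<) ,
            trans (cong (member k₂) (toℕ-injective (trans (cong suc (toℕ-fromℕ< (≤-pred r<))) (sym (toℕ-fromℕ< r<))))) mr

  pathOffset : Fin 4 → ℕ
  pathOffset p₀ = 2
  pathOffset p₁ = off₁
  pathOffset p₂ = 2
  pathOffset p₃ = off₃

  2≤pathOffset : ∀ f → 2 ≤ pathOffset f
  2≤pathOffset p₀ = ≤-refl
  2≤pathOffset p₁ = 2≤off₁
  2≤pathOffset p₂ = ≤-refl
  2≤pathOffset p₃ = 2≤off₃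

  pathLabelOf-inner : ∀ f i → 0 < i → i < pathLength f → pathLabelOf f i ≡ pathOffset f + i
  pathLabelOf-inner p₀ i 0<i i< = pathLabel-inner 0 1 2 a i 0<i i<
  pathLabelOf-inner p₁ i 0<i i< = pathLabel-inner 0 1 off₁ b i 0<i i<
  pathLabelOf-inner p₂ i 0<i (s≤s i≤0) = ⊥-elim (<⇒≱ 0<i i≤0)
  pathLabelOf-inner p₃ i 0<i i< = pathLabel-inner 2 0 off₃ c i 0<i i<

  private
    after : ∀ x y j m → x + m ≤ y → 0 < j → ∀ i → i ≤ m → x + i ≢ y + j
    after x y j m x+m≤y 0<j i i≤m eq = label-ranges-disjoint x y i j m eq i≤m x+m≤y 0<j

  inner-labels-disjoint : ∀ f g i j → 0 < i → i < pathLength f → 0 < j → j < pathLength g →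
                          pathOffset f + i ≡ pathOffset g + j → f ≡ g
  inner-labels-disjoint p₀ p₀ _ _ _ _ _ _ _ = refl
  inner-labels-disjoint p₁ p₁ _ _ _ _ _ _ _ = refl
  inner-labels-disjoint p₃ p₃ _ _ _ _ _ _ _ = refl
  inner-labels-disjoint p₂ g i j 0<i (s≤s i≤0) _ _ _ = ⊥-elim (<⇒≱ 0<i i≤0)
  inner-labels-disjoint f p₂ i j _ _ 0<j (s≤s j≤0) _ = ⊥-elim (<⇒≱ 0<j j≤0)
  inner-labels-disjoint p₀ p₁ i j _ i< 0<j _ eq = ⊥-elim (after 2 off₁ j a ≤-refl 0<j i (≤-pred i<) eq)
  inner-labels-disjoint p₁ p₀ i j 0<i _ _ j< eq = ⊥-elim (after 2 off₁ i a ≤-refl 0<i j (≤-pred j<) (sym eq))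
  inner-labels-disjoint p₀ p₃ i j _ i< 0<j _ eq = ⊥-elim (after 2 off₃ j a (m≤m+n off₁ b) 0<j i (≤-pred i<) eq)
  inner-labels-disjoint p₃ p₀ i j 0<i _ _ j< eq = ⊥-elim (after 2 off₃ i a (m≤m+n off₁ b) 0<i j (≤-pred j<) (sym eq))
  inner-labels-disjoint p₁ p₃ i j _ i< 0<j _ eq = ⊥-elim (after off₁ off₃ j b ≤-refl 0<j i (≤-pred i<) eq)
  inner-labels-disjoint p₃ p₁ i j 0<i _ _ j< eq = ⊥-elim (after off₁ off₃ i b ≤-refl 0<i j (≤-pred j<) (sym eq))

  private
    branch≤N : ∀ (u : Fin 3) → toℕ u ≤ N
    branch≤N u = ≤-trans (≤-pred (toℕ<n u)) 2≤N

    vert≤N : ∀ f (i : Fin (suc (pathLength f))) → pathLabelOf f (toℕ i) ≤ N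
    vert≤N f i = pathLabelOf≤N f (toℕ i) (≤-pred (toℕ<n i))

    inner-vertex : ∀ f (v : Fin (suc N)) → pathOffset f < toℕ v → toℕ v < pathOffset f + pathLength f →
      ∃[ i ] (0 < toℕ i × toℕ i < pathLength f × vert (path f) i ≡ v)
    inner-vertex f v off< <off+ = i , subst (0 <_) (sym toℕi≡i') 0<i' , subst (_< pathLength f) (sym toℕi≡i') i'<len , vert≡
      where
      i' : ℕ
      i' = toℕ v ∸ pathOffset f
      off+i'≡v : pathOffset f + i' ≡ toℕ v
      off+i'≡v = m+[n∸m]≡n (<⇒≤ off<)
      0<i' : 0 < i'
      0<i' = m<n⇒0<n∸m off<
      i'<len : i' < pathLength f
      i'<len = +-cancelˡ-< (pathOffset f) i' _ (subst (_< _) (sym off+i'≡v) <off+)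
      i : Fin (suc (pathLength f))
      i = fromℕ< (m<n⇒m<1+n i'<len)
      toℕi≡i' : toℕ i ≡ i'
      toℕi≡i' = toℕ-fromℕ< _
      vert≡ : clamp N (pathLabelOf f (toℕ i)) ≡ v
      vert≡ = begin
        clamp N (pathLabelOf f (toℕ i))  ≡⟨ cong (λ k → clamp N (pathLabelOf f k)) toℕi≡i' ⟩
        clamp N (pathLabelOf f i')       ≡⟨ cong (clamp N) (trans (pathLabelOf-inner f i' 0<i' i'<len) off+i'≡v) ⟩
        clamp N (toℕ v)                  ≡⟨ clamp-toℕ N v ⟩
        v                                ∎
        where open ≡-Reasoning

  private
    <+suc : ∀ {x} o m → x ≤ o + m → x < o + suc m
    <+suc {x} o m x≤ = subst (x <_) (sym (+-suc o m)) (s≤s x≤)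

  vertex-cover : ∀ (v : Fin (suc N)) →
    (∃[ u ] clamp N (toℕ u) ≡ v) ⊎ (∃[ f ] ∃[ i ] (0 < toℕ i × toℕ i < pathLength f × vert (path f) i ≡ v))
  vertex-cover v with toℕ v <? 3
  ... | yes v<3 = inj₁ (fromℕ< v<3 , trans (cong (clamp N) (toℕ-fromℕ< v<3)) (clamp-toℕ N v))
  ... | no v≮3 with toℕ v ≤? 2 + a
  ...   | yes v≤ = inj₂ (p₀ , inner-vertex p₀ v (≮⇒≥ v≮3) (s≤s v≤))
  ...   | no v≰ with toℕ v ≤? off₁ + b
  ...     | yes v≤' = inj₂ (p₁ , inner-vertex p₁ v (≰⇒> v≰) (<+suc off₁ b v≤'))
  ...     | no v≰' = inj₂ (p₃ , inner-vertex p₃ v (≰⇒> v≰') (<+suc off₃ c (≤-pred (toℕ<n v))))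

  pathLength-odd : ∀ f → Odd (pathLength f)
  pathLength-odd p₀ = odd-a
  pathLength-odd p₁ = odd-b
  pathLength-odd p₂ = refl
  pathLength-odd p₃ = odd-c

  pathLabelOf-start : ∀ f → pathLabelOf f 0 ≡ toℕ (source f)
  pathLabelOf-start p₀ = refl
  pathLabelOf-start p₁ = refl
  pathLabelOf-start p₂ = refl
  pathLabelOf-start p₃ = refl

  pathLabelOf-finish : ∀ f → pathLabelOf f (pathLength f) ≡ toℕ (target f)
  pathLabelOf-finish p₀ = pathLabel-end 0 1 2 a
  pathLabelOf-finish p₁ = pathLabel-end 0 1 off₁ b
  pathLabelOf-finish p₂ = refl
  pathLabelOf-finish p₃ = pathLabel-end 2 0 off₃ c

  T : TotallyOddSubdivision G C3⁺
  T = record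
    { φ                = λ u → clamp N (toℕ u)
    ; φ-inj            = λ {u} {u'} eq → toℕ-injective (clamp-injective N _ _ (branch≤N u) (branch≤N u') eq)
    ; len              = pathLength
    ; len-odd          = pathLength-odd
    ; path             = path
    ; path-start       = λ f → cong (clamp N) (pathLabelOf-start f)
    ; path-finish      = λ f → cong (clamp N) (trans (cong (pathLabelOf f) (toℕ-fromℕ (pathLength f))) (pathLabelOf-finish f))
    ; edge-cover       = pathEdge-cover
    ; edge-uniq        = pathEdge-unique
    ; vert-cover       = vertex-cover
    ; inner-not-branch = λ f i u 0<i i< eq →
        <⇒≱ (toℕ<n u) (subst (3 ≤_)
          (trans (sym (pathLabelOf-inner f (toℕ i) 0<i i<)) (clamp-injective N _ _ (vert≤N f i) (branch≤N u) eq))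
          (3≤off+i (pathOffset f) (toℕ i) (2≤pathOffset f) 0<i))
    ; inner-disjoint   = λ f g i j 0<i i< 0<j j< eq →
        inner-labels-disjoint f g (toℕ i) (toℕ j) 0<i i< 0<j j<
          (trans (sym (pathLabelOf-inner f (toℕ i) 0<i i<))
            (trans (clamp-injective N _ _ (vert≤N f i) (vert≤N g j) eq) (pathLabelOf-inner g (toℕ j) 0<j j<)))
    }

  private
    open Subdivision G T using (owner)
    open PathUnion G T using (pathUnion)

    colourOf-owner : ∀ x → colourOf (owner x) ≡ col x
    colourOf-owner x with pathEdge-cover x
    ... | f , i , refl = sym (colour-pathEdge f i)

    pathUnion≡colourUnion : ∀ S cs → (∀ f → S f ≡ cs (colourOf f)) → pathUnion S ≡ colourUnion col cs
    pathUnion≡colourUnion S cs S≗ = tabulate-cong λ x → trans (S≗ (owner x)) (cong cs (colourOf-owner x))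

  -- M(G) has exactly the three circuits p₀ ∪ p₁, p₀ ∪ p₂ ∪ p₃ and p₁ ∪ p₂ ∪ p₃, that is, the unions of two colour classes.
  colourUnions-realised : (M : Matroid n) →
    (∀ D → Circuit M D ⇔ OneOf D (colourUnion col colours01) (colourUnion col colours02) (colourUnion col colours12)) → IsOddC3⁺ M
  colourUnions-realised M circuit⇔ = G , T , mk⤖ {to = λ x → x} ((λ eq → eq) , (λ y → y , (λ eq → eq))) , iso
    where
    U01 : pathUnion paths01 ≡ colourUnion col colours01
    U01 = pathUnion≡colourUnion paths01 colours01 λ { p₀ → refl ; p₁ → refl ; p₂ → refl ; p₃ → refl }
    U023 : pathUnion paths023 ≡ colourUnion col colours02
    U023 = pathUnion≡colourUnion paths023 colours02 λ { p₀ → refl ; p₁ → refl ; p₂ → refl ; p₃ → refl }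
    U123 : pathUnion paths123 ≡ colourUnion col colours12
    U123 = pathUnion≡colourUnion paths123 colours12 λ { p₀ → refl ; p₁ → refl ; p₂ → refl ; p₃ → refl }
    iso : ∀ (D : Subset n) → IsCycleSet G D ⇔ Circuit M (tabulate λ i → lookup D i)
    iso D = mk⇔ cycle⇒circuit circuit⇒cycle
      where
      cycle⇒circuit : IsCycleSet G D → Circuit M (tabulate λ i → lookup D i)
      cycle⇒circuit cyc = subst (Circuit M) (sym (tabulate∘lookup D)) (Equivalence.from (circuit⇔ D) D≡)
        where
        D≡ : OneOf D (colourUnion col colours01) (colourUnion col colours02) (colourUnion col colours12)
        D≡ with CycleClassification.cycle-classification G T D cyc
        ... | inj₁ e        = inj₁ (trans e U01)
        ... | inj₂ (inj₁ e) = inj₂ (inj₁ (trans e U023))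
        ... | inj₂ (inj₂ e) = inj₂ (inj₂ (trans e U123))
      circuit⇒cycle : Circuit M (tabulate λ i → lookup D i) → IsCycleSet G D
      circuit⇒cycle D-circ with Equivalence.to (circuit⇔ D) (subst (Circuit M) (tabulate∘lookup D) D-circ)
      ... | inj₁ e        = subst (IsCycleSet G) (sym (trans e (sym U01))) (SubdivisionCycles.paths01-cycle G T)
      ... | inj₂ (inj₁ e) = subst (IsCycleSet G) (sym (trans e (sym U023))) (SubdivisionCycles.paths023-cycle G T)
      ... | inj₂ (inj₂ e) = subst (IsCycleSet G) (sym (trans e (sym U123))) (SubdivisionCycles.paths123-cycle G T)

even-positive : ∀ m → parity m ≡ false → m ≢ 0 → Σ ℕ λ c → m ≡ suc (suc c) × Odd (suc c)
even-positive zero          _ m≢0 = ⊥-elim (m≢0 refl)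
even-positive (suc (suc c)) p _ with parity c in pc
even-positive (suc (suc c)) () _ | true
... | false = c , refl , parity⇒Odd (suc c) (cong not pc)

colouring⇒OddC3⁺ : ∀ {n} (M : Matroid n) (col : Fin n → Fin 3) →
  Odd ∣ colourClass col k₀ ∣ → Odd ∣ colourClass col k₁ ∣ →
  parity ∣ colourClass col k₂ ∣ ≡ false → ∣ colourClass col k₂ ∣ ≢ 0 →
  (∀ D → Circuit M D ⇔ OneOf D (colourUnion col colours01) (colourUnion col colours02) (colourUnion col colours12)) →
  IsOddC3⁺ M
colouring⇒OddC3⁺ {n} M col odd₀ odd₁ even₂ K₂≢0 circuit⇔
  with Odd⇒suc _ odd₀ | Odd⇒suc _ odd₁ | even-positive _ even₂ K₂≢0
... | a , ∣K₀∣ | b , ∣K₁∣ | c , ∣K₂∣ , odd-c =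
  Construction.colourUnions-realised n col a b c ∣K₀∣ ∣K₁∣ ∣K₂∣ (subst Odd ∣K₀∣ odd₀) (subst Odd ∣K₁∣ odd₁) odd-c M circuit⇔

-- Colour the ground set by membership in C₁ ∩ C₂, C₁ ─ C₂ and C₂ ─ C₁: since |C₁| is odd exactly one of
-- the first two parts is odd; it becomes class k₀, C₂ ─ C₁ becomes k₁, and the even part becomes k₂.
module ThreeCircuits⇒OddC3⁺ {n : ℕ} (M : Matroid n) (C₁ C₂ : Subset n) (C₁-circ : Circuit M C₁)
    (C₁∪C₂≡⊤ : C₁ ∪ C₂ ≡ ⊤) (odd₁ : Odd ∣ C₁ ∣) (odd₂₁ : Odd ∣ C₂ ─ C₁ ∣)
    (circuit⇔ : ∀ C → Circuit M C ⇔ OneOf C C₁ C₂ (C₁ Δ C₂)) where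

  private
    in₁ in₂ : Fin n → Bool
    in₁ = lookup C₁
    in₂ = lookup C₂

    covered : ∀ x → in₁ x ∨ in₂ x ≡ true
    covered x = trans (sym (lookup-zipWith _∨_ x C₁ C₂)) (trans (cong (λ C → lookup C x) C₁∪C₂≡⊤) (lookup-replicate x true))

    X Y Z : Subset n
    X = C₁ ∩ C₂
    Y = C₁ ─ C₂
    Z = C₂ ─ C₁

    membership-ext : ∀ (V W : Subset n) (g h : Bool → Bool → Bool) →
      (∀ x → lookup V x ≡ g (in₁ x) (in₂ x)) → (∀ x → lookup W x ≡ h (in₁ x) (in₂ x)) →
      g true true ≡ h true true → g true false ≡ h true false → g false true ≡ h false true → V ≡ W
    membership-ext V W g h V≗ W≗ tt tf ft = lookup-ext λ x → trans (V≗ x) (trans (agree (in₁ x) (in₂ x) (covered x)) (sym (W≗ x)))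
      where
      agree : ∀ u v → u ∨ v ≡ true → g u v ≡ h u v
      agree true  true  _ = tt
      agree true  false _ = tf
      agree false true  _ = ft

    lookup-X : ∀ x → lookup X x ≡ in₁ x ∧ in₂ x
    lookup-X x = lookup-zipWith _∧_ x C₁ C₂
    lookup-Y : ∀ x → lookup Y x ≡ in₁ x ∧ not (in₂ x)
    lookup-Y = lookup-─ C₁ C₂
    lookup-Z : ∀ x → lookup Z x ≡ in₂ x ∧ not (in₁ x)
    lookup-Z = lookup-─ C₂ C₁
    lookup-Δ : ∀ x → lookup (C₁ Δ C₂) x ≡ in₁ x xor in₂ x
    lookup-Δ x = lookup-zipWith _xor_ x C₁ C₂

    parity-X-xor-Y : parity ∣ X ∣ xor parity ∣ Y ∣ ≡ true
    parity-X-xor-Y = trans (sym (parity-+ ∣ X ∣ ∣ Y ∣)) (trans (cong parity (sym (∣p∣≡∣p∩q∣+∣p─q∣ C₁ C₂))) (Odd⇒parity ∣ C₁ ∣ odd₁))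

    Δ-circ : Circuit M (C₁ Δ C₂)
    Δ-circ = Equivalence.from (circuit⇔ _) (inj₂ (inj₂ refl))

    colouring : (Bool → Bool → Fin 3) → Fin n → Fin 3
    colouring F x = F (in₁ x) (in₂ x)

    class-by-membership : ∀ F k (W : Subset n) h → (∀ x → lookup W x ≡ h (in₁ x) (in₂ x)) →
      does (F true true ≟ k) ≡ h true true → does (F true false ≟ k) ≡ h true false →
      does (F false true ≟ k) ≡ h false true → colourClass (colouring F) k ≡ W
    class-by-membership F k W h = membership-ext (colourClass (colouring F) k) W (λ u v → does (F u v ≟ k)) h
                                    (λ x → lookup∘tabulate _ x)

    union-by-membership : ∀ F cs (W : Subset n) h → (∀ x → lookup W x ≡ h (in₁ x) (in₂ x)) →
      cs (F true true) ≡ h true true → cs (F true false) ≡ h true false → cs (F false true) ≡ h false true →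
      colourUnion (colouring F) cs ≡ W
    union-by-membership F cs W h = membership-ext (colourUnion (colouring F) cs) W (λ u v → cs (F u v)) h
                                     (λ x → lookup∘tabulate _ x)

    false≢true : false ≢ true
    false≢true ()

    -- X empty would make C₁ ⊆ C₁ Δ C₂
    X≢∅ : ∣ X ∣ ≢ 0
    X≢∅ ∣X∣≡0 with Odd⇒suc _ odd₂₁
    ... | _ , ∣Z∣≡suc with ∣p∣≡suc⇒nonempty Z ∣Z∣≡suc
    ...   | z , z∈Z = false≢true (begin
      false                ≡⟨ sym (proj₁ z-memberships) ⟩
      lookup C₁ z          ≡⟨ cong (λ C → lookup C z) C₁≡Δ ⟩
      lookup (C₁ Δ C₂) z   ≡⟨ lookup-Δ z ⟩
      in₁ z xor in₂ z      ≡⟨ cong₂ _xor_ (proj₁ z-memberships) (proj₂ z-memberships) ⟩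
      true                 ∎)
      where
      open ≡-Reasoning
      C₁⊆Δ : C₁ ⊆ C₁ Δ C₂
      C₁⊆Δ {x} x∈C₁ with in₁ x in e₁ | in₂ x in e₂
      ... | true  | true  = ⊥-elim (∣p∣≡0⇒∉ X x ∣X∣≡0 (trans (lookup-X x) (cong₂ _∧_ e₁ e₂)))
      ... | true  | false = lookup⇒[]= x _ (trans (lookup-Δ x) (cong₂ _xor_ e₁ e₂))
      ... | false | _     = ⊥-elim (false≢true (trans (sym e₁) ([]=⇒lookup x∈C₁)))
      C₁≡Δ : C₁ ≡ C₁ Δ C₂
      C₁≡Δ = circ-minimal M C₁ (C₁ Δ C₂) C₁-circ Δ-circ C₁⊆Δ
      z-memberships : in₁ z ≡ false × in₂ z ≡ true
      z-memberships with in₁ z | in₂ z | trans (sym (lookup-Z z)) z∈Z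
      ... | false | true | _ = refl , refl

    -- Y empty would make C₁ ⊆ C₂, hence C₁ = C₂ and C₁ Δ C₂ = ∅
    Y≢∅ : ∣ Y ∣ ≢ 0
    Y≢∅ ∣Y∣≡0 with circ-nonempty M (C₁ Δ C₂) Δ-circ
    ... | x , x∈Δ = false≢true (begin
      false                ≡⟨ sym (xor-same (in₁ x)) ⟩
      in₁ x xor in₁ x      ≡⟨ cong (λ C → in₁ x xor lookup C x) C₁≡C₂ ⟩
      in₁ x xor in₂ x      ≡⟨ sym (lookup-Δ x) ⟩
      lookup (C₁ Δ C₂) x   ≡⟨ []=⇒lookup x∈Δ ⟩
      true                 ∎)
      where
      open ≡-Reasoning
      C₁⊆C₂ : C₁ ⊆ C₂
      C₁⊆C₂ {x} x∈C₁ with in₁ x in e₁ | in₂ x in e₂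
      ... | _     | true  = lookup⇒[]= x C₂ e₂
      ... | true  | false = ⊥-elim (∣p∣≡0⇒∉ Y x ∣Y∣≡0 (trans (lookup-Y x) (cong₂ (λ u v → u ∧ not v) e₁ e₂)))
      ... | false | false = ⊥-elim (false≢true (trans (sym e₁) ([]=⇒lookup x∈C₁)))
      C₁≡C₂ : C₁ ≡ C₂
      C₁≡C₂ = circ-minimal M C₁ C₂ C₁-circ (Equivalence.from (circuit⇔ _) (inj₂ (inj₁ refl))) C₁⊆C₂

    recolour : ∀ {A B C : Subset n} (F : Bool → Bool → Fin 3) → (∀ D → OneOf D C₁ C₂ (C₁ Δ C₂) ⇔ OneOf D A B C) →
      colourUnion (colouring F) colours01 ≡ A → colourUnion (colouring F) colours02 ≡ B →
      colourUnion (colouring F) colours12 ≡ C →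
      ∀ D → Circuit M D ⇔ OneOf D (colourUnion (colouring F) colours01) (colourUnion (colouring F) colours02)
                                  (colourUnion (colouring F) colours12)
    recolour F permute refl refl refl D = permute D ⇔-∘ circuit⇔ D

    even-X : parity ∣ X ∣ ≡ false → IsOddC3⁺ M
    even-X even = colouring⇒OddC3⁺ M (colouring F) (subst Odd (sym ∣K₀∣) odd-Y) (subst Odd (sym ∣K₁∣) odd₂₁)
      (trans (cong parity ∣K₂∣) even) (λ eq → X≢∅ (trans (sym ∣K₂∣) eq))
      (recolour F (λ _ → oneOf-rotate)
        (union-by-membership F colours01 (C₁ Δ C₂) _xor_ lookup-Δ refl refl refl)
        (union-by-membership F colours02 C₁ (λ u _ → u) (λ _ → refl) refl refl refl)
        (union-by-membership F colours12 C₂ (λ _ v → v) (λ _ → refl) refl refl refl))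
      where
      F : Bool → Bool → Fin 3
      F true  true  = k₂
      F true  false = k₀
      F false _     = k₁
      odd-Y : Odd ∣ Y ∣
      odd-Y = parity⇒Odd ∣ Y ∣ (subst (λ p → p xor parity ∣ Y ∣ ≡ true) even parity-X-xor-Y)
      ∣K₀∣ : ∣ colourClass (colouring F) k₀ ∣ ≡ ∣ Y ∣
      ∣K₀∣ = cong ∣_∣ (class-by-membership F k₀ Y (λ u v → u ∧ not v) lookup-Y refl refl refl)
      ∣K₁∣ : ∣ colourClass (colouring F) k₁ ∣ ≡ ∣ Z ∣
      ∣K₁∣ = cong ∣_∣ (class-by-membership F k₁ Z (λ u v → v ∧ not u) lookup-Z refl refl refl)
      ∣K₂∣ : ∣ colourClass (colouring F) k₂ ∣ ≡ ∣ X ∣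
      ∣K₂∣ = cong ∣_∣ (class-by-membership F k₂ X _∧_ lookup-X refl refl refl)

    odd-X : parity ∣ X ∣ ≡ true → IsOddC3⁺ M
    odd-X odd = colouring⇒OddC3⁺ M (colouring F) (subst Odd (sym ∣K₀∣) (parity⇒Odd ∣ X ∣ odd)) (subst Odd (sym ∣K₁∣) odd₂₁)
      (trans (cong parity ∣K₂∣) even-Y) (λ eq → Y≢∅ (trans (sym ∣K₂∣) eq))
      (recolour F (λ _ → oneOf-swap)
        (union-by-membership F colours01 C₂ (λ _ v → v) (λ _ → refl) refl refl refl)
        (union-by-membership F colours02 C₁ (λ u _ → u) (λ _ → refl) refl refl refl)
        (union-by-membership F colours12 (C₁ Δ C₂) _xor_ lookup-Δ refl refl refl))
      where
      F : Bool → Bool → Fin 3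
      F true  true  = k₀
      F true  false = k₂
      F false _     = k₁
      even-Y : parity ∣ Y ∣ ≡ false
      even-Y with parity ∣ Y ∣ | subst (λ p → p xor parity ∣ Y ∣ ≡ true) odd parity-X-xor-Y
      ... | false | _ = refl
      ∣K₀∣ : ∣ colourClass (colouring F) k₀ ∣ ≡ ∣ X ∣
      ∣K₀∣ = cong ∣_∣ (class-by-membership F k₀ X _∧_ lookup-X refl refl refl)
      ∣K₁∣ : ∣ colourClass (colouring F) k₁ ∣ ≡ ∣ Z ∣
      ∣K₁∣ = cong ∣_∣ (class-by-membership F k₁ Z (λ u v → v ∧ not u) lookup-Z refl refl refl)
      ∣K₂∣ : ∣ colourClass (colouring F) k₂ ∣ ≡ ∣ Y ∣
      ∣K₂∣ = cong ∣_∣ (class-by-membership F k₂ Y (λ u v → u ∧ not v) lookup-Y refl refl refl)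

  oddC3⁺ : IsOddC3⁺ M
  oddC3⁺ with parity ∣ X ∣ in parity-X
  ... | false = even-X parity-X
  ... | true  = odd-X parity-X

oddC3⁺⇒threeCircuits : ∀ {n} (M : Matroid n) → IsOddC3⁺ M → ThreeCircuits M
oddC3⁺⇒threeCircuits M (G , T , σ , iso) =
  C₁ , C₂ , Circuit-C₁ , Circuit-C₂ , C₁∪C₂≡⊤ , Odd∣C₁∣ , Odd∣C₂─C₁∣ , circuit⇔
  where open OddC3⁺⇒ThreeCircuits M G T σ iso

threeCircuits⇒oddC3⁺ : ∀ {n} (M : Matroid n) → ThreeCircuits M → IsOddC3⁺ M
threeCircuits⇒oddC3⁺ M (C₁ , C₂ , C₁-circ , _ , C₁∪C₂≡⊤ , odd₁ , odd₂₁ , circuit⇔) =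
  ThreeCircuits⇒OddC3⁺.oddC3⁺ M C₁ C₂ C₁-circ C₁∪C₂≡⊤ odd₁ odd₂₁ circuit⇔

proposition2p6 : ∀ {n : ℕ} (M : Matroid n) →
    IsOddC3⁺ M ⇔
    (∃[ C₁ ] ∃[ C₂ ] ( Circuit M C₁ × Circuit M C₂
                     × (C₁ ∪ C₂ ≡ ⊤)
                     × Odd ∣ C₁ ∣
                     × Odd ∣ C₂ ─ C₁ ∣
                     × (∀ C → Circuit M C ⇔ (C ≡ C₁ ⊎ C ≡ C₂ ⊎ C ≡ C₁ Δ C₂))))
proposition2p6 M = mk⇔ (oddC3⁺⇒threeCircuits M) (threeCircuits⇒oddC3⁺ M)
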